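{- Let $p<q<r$ be primes. There is no small recurrent integer $N>1$ such that the four smallest elements of $S'_N$ are $p<q<r<p^2$.
   Context: $S'_N=\{d:1<d<\sqrt N,\ d\mid N\}$. $N$ is small recurrent if there are integers $a,b$ such that the elements $x_1<x_2<\cdots$ of $S'_N$ satisfy $x_i=ax_{i-1}+bx_{i-2}$ for all $i\ge3$ (vacuously true if $|S'_N|\le2$). -}

module Defs where

open import Data.Nat using (ℕ; _<_; _*_; _<?_)
open import Data.Nat.Divisibility using (_∣_; _∣?_)
open import Data.List using (List; []; _∷_; filter; upTo)
open import Data.Integer as ℤ using (ℤ; +_)
open import Data.Product using (_×_; ∃₂)
open import Data.Unit using (⊤)
open import Relation.Binary.PropositionalEquality using (_≡_)
open import Relation.Nullary.Decidable using (_×-dec_)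

-- S'_N = { d : 1 < d < √N , d ∣ N }, listed in increasing order.
-- The condition d < √N is expressed as d * d < N (equivalent for naturals).
S′ : ℕ → List ℕ
S′ N = filter (λ d → (1 <? d) ×-dec ((d * d <? N) ×-dec (d ∣? N))) (upTo N)

Rec : ℤ → ℤ → List ℕ → Set
Rec a b (x ∷ y ∷ z ∷ rest) = (+ z ≡ a ℤ.* + y ℤ.+ b ℤ.* + x) × Rec a b (y ∷ z ∷ rest)
Rec a b _ = ⊤

SmallRecurrent : ℕ → Set
SmallRecurrent N = ∃₂ λ (a b : ℤ) → Rec a b (S′ N)

module Submission where

-- As p², q and r divide N and are pairwise coprime,
-- p²qr ≤ N, so (pq)² < N and pq ∈ S′_N.  Modulo p the recurrence gives p ∣ a² + b and p ∤ ab, so the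
-- fifth and sixth elements s, t are prime to p and the seventh is a multiple cp of p with c ∈ S′_N,
-- hence c ≥ q: the seventh element is pq.  Writing a² + b = kp, the seven terms give p = kq + ab,
-- q = ks + abp (forcing k > 0) and q = (a³ + 3ab)p + b³.  The case ab ≥ 0 contradicts p < q, and
-- a < 0 < b contradicts p² < s; for a = A > 0 > b = −β the remaining Diophantine system in A, β, k, p
-- has the single solution A = 2, β = 1, p = 3 (for A ≤ β one uses t < pq and size estimates).
-- So S′_N begins 3, 5, 7, 9, 11, 13, 15 with x₍ᵢ₊₂₎ = 2x₍ᵢ₊₁₎ − xᵢ.  For consecutive odd u, u + 2, u + 4
-- in S′_N with u ≥ 11 these are pairwise coprime, so u(u + 2)(u + 4) ∣ N, and 3(u + 2) or 3(u + 4)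
-- is an element of S′_N beyond u + 4; the recurrence makes the next element u + 6.  The run of odd
-- numbers in S′_N would therefore never end, although S′_N is finite.

module Primes where

  open import Data.Nat
  open import Data.Nat.Properties
  open import Data.Nat.Divisibility using (_∣_; _∣?_; divides; ∣-trans; ∣m+n∣m⇒∣n)
  open import Data.Nat.Coprimality using (Coprime; coprime-divisor; coprime-+)
  import Data.Nat.Coprimality as Coprime
  open import Data.Nat.Primality using (Prime; prime?; prime[2]; euclidsLemma; prime⇒irreducible; prime⇒nonTrivial)
  open import Data.Product using (_,_)
  open import Data.Sum using (inj₁; inj₂; [_,_]′)
  open import Relation.Nullary using (¬_; contradiction)
  open import Relation.Nullary.Decidable using (from-yes; from-no)
  open import Relation.Binary.PropositionalEquality

  prime⇒1<p : ∀ {p} → Prime p → 1 < p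
  prime⇒1<p {p} prime-p = nonTrivial⇒n>1 p {{prime⇒nonTrivial prime-p}}

  prime∤larger-prime : ∀ {p ℓ} → Prime p → Prime ℓ → p < ℓ → ¬ p ∣ ℓ
  prime∤larger-prime prime-p prime-ℓ p<ℓ p∣ℓ with prime⇒irreducible prime-ℓ p∣ℓ
  ... | inj₁ refl = <-irrefl refl (prime⇒1<p prime-p)
  ... | inj₂ refl = <-irrefl refl p<ℓ

  ¬∣⇒coprime : ∀ {ℓ m} → Prime ℓ → ¬ ℓ ∣ m → Coprime ℓ m
  ¬∣⇒coprime prime-ℓ ℓ∤m (d∣ℓ , d∣m) with prime⇒irreducible prime-ℓ d∣ℓ
  ... | inj₁ d≡1 = d≡1
  ... | inj₂ refl = contradiction d∣m ℓ∤m

  prime∤*⇒∤ : ∀ {ℓ m n} → Prime ℓ → ¬ ℓ ∣ m → ¬ ℓ ∣ n → ¬ ℓ ∣ m * n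
  prime∤*⇒∤ {m = m} {n} prime-ℓ ℓ∤m ℓ∤n ℓ∣mn = [ ℓ∤m , ℓ∤n ]′ (euclidsLemma m n prime-ℓ ℓ∣mn)

  coprime⇒*∣ : ∀ {m n k} → Coprime m n → m ∣ k → n ∣ k → m * n ∣ k
  coprime⇒*∣ {m} {n} {k} m⊥n (divides c k≡cm) n∣k with coprime-divisor (Coprime.sym m⊥n) n∣mc
    where
    n∣mc : n ∣ m * c
    n∣mc = subst (n ∣_) (trans k≡cm (*-comm c m)) n∣k
  ... | divides d c≡dn = divides d (begin
    k              ≡⟨ k≡cm ⟩
    c * m          ≡⟨ cong (_* m) c≡dn ⟩
    d * n * m      ≡⟨ *-assoc d n m ⟩
    d * (n * m)    ≡⟨ cong (d *_) (*-comm n m) ⟩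
    d * (m * n)    ∎)
    where open ≡-Reasoning

  coprime-*ˡ : ∀ {m o n} → Coprime m n → Coprime o n → Coprime (m * o) n
  coprime-*ˡ {m} {o} {n} m⊥n o⊥n (d∣mo , d∣n) = o⊥n (coprime-divisor d⊥m d∣mo , d∣n)
    where
    d⊥m : Coprime _ m
    d⊥m (e∣d , e∣m) = m⊥n (e∣m , ∣-trans e∣d d∣n)

  odd⇒coprime-+2 : ∀ {u} → ¬ 2 ∣ u → Coprime u (u + 2)
  odd⇒coprime-+2 2∤u = Coprime.sym (coprime-+ (¬∣⇒coprime prime[2] 2∤u))

  odd⇒coprime-+4 : ∀ {u} → ¬ 2 ∣ u → Coprime u (u + 4)
  odd⇒coprime-+4 {u} 2∤u = Coprime.sym (coprime-+ (coprime-*ˡ {2} {2} 2⊥u 2⊥u))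
    where
    2⊥u : Coprime 2 u
    2⊥u = ¬∣⇒coprime prime[2] 2∤u

  odd⇒odd-+2 : ∀ {u} → ¬ 2 ∣ u → ¬ 2 ∣ u + 2
  odd⇒odd-+2 {u} 2∤u 2∣u+2 = 2∤u (∣m+n∣m⇒∣n (subst (2 ∣_) (+-comm u 2) 2∣u+2) (divides 1 refl))

  3∣v⇒3∤v+2 : ∀ v → 3 ∣ v → ¬ 3 ∣ v + 2
  3∣v⇒3∤v+2 v 3∣v 3∣v+2 = from-no (3 ∣? 2) (∣m+n∣m⇒∣n 3∣v+2 3∣v)

  prime[3] : Prime 3
  prime[3] = from-yes (prime? 3)

module SmallDivisors where

  open import Defs
  open import Data.Nat
  open import Data.Nat.Properties
  open import Data.Nat.Divisibility using (_∣_; _∣?_)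
  open import Data.Integer using (ℤ)
  open import Data.List using ([]; _∷_; _++_; upTo)
  open import Data.List.Membership.Propositional using (_∈_)
  open import Data.List.Membership.Propositional.Properties using (∈-filter⁺; ∈-filter⁻; ∈-upTo⁺; ∈-upTo⁻; ∈-++⁺ʳ)
  open import Data.List.Relation.Unary.Any using (here; there)
  import Data.List.Relation.Unary.All as All
  open import Data.List.Relation.Unary.AllPairs using (AllPairs; []; _∷_)
  open import Data.List.Relation.Unary.AllPairs.Properties using (applyUpTo⁺₁; filter⁺)
  open import Data.Product using (_×_; _,_; proj₁; proj₂)
  open import Data.Unit using (tt)
  open import Data.Empty using (⊥; ⊥-elim)
  open import Relation.Nullary using (Dec)
  open import Relation.Nullary.Decidable using (_×-dec_)
  open import Relation.Binary.PropositionalEquality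
  open import Function using (id)

  private
    small-divisor? : ∀ N d → Dec (1 < d × d * d < N × d ∣ N)
    small-divisor? N d = (1 <? d) ×-dec ((d * d <? N) ×-dec (d ∣? N))

  ∈S′⁻ : ∀ N {d} → d ∈ S′ N → 1 < d × d * d < N × d ∣ N
  ∈S′⁻ N d∈S′ = proj₂ (∈-filter⁻ (small-divisor? N) {xs = upTo N} d∈S′)

  ∈S′⇒<N : ∀ N {d} → d ∈ S′ N → d < N
  ∈S′⇒<N N d∈S′ = ∈-upTo⁻ (proj₁ (∈-filter⁻ (small-divisor? N) {xs = upTo N} d∈S′))

  ∈S′⁺ : ∀ {N d} → 1 < d → d * d < N → d ∣ N → d ∈ S′ N
  ∈S′⁺ {N} {d} 1<d d²<N d∣N = ∈-filter⁺ (small-divisor? N) (∈-upTo⁺ d<N) (1<d , d²<N , d∣N)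
    where
    d<N : d < N
    d<N = ≤-<-trans (m≤m*n d d {{>-nonZero (<-trans z<s 1<d)}}) d²<N

  S′-sorted : ∀ N → AllPairs _<_ (S′ N)
  S′-sorted N = filter⁺ (small-divisor? N) (applyUpTo⁺₁ id N (λ i<j _ → i<j))

  sorted-head-≤ : ∀ {x y xs} → AllPairs _<_ (x ∷ xs) → y ∈ x ∷ xs → x ≤ y
  sorted-head-≤ _ (here refl) = ≤-refl
  sorted-head-≤ (x<xs ∷ _) (there y∈xs) = <⇒≤ (All.lookup x<xs y∈xs)

  sorted-gap : ∀ {x y z zs} → AllPairs _<_ (x ∷ y ∷ zs) → z ∈ x ∷ y ∷ zs → x < z → z < y → ⊥
  sorted-gap _ (here refl) x<z _ = <-irrefl refl x<z
  sorted-gap (_ ∷ y<zs) (there z∈y∷zs) _ z<y = <⇒≱ z<y (sorted-head-≤ y<zs z∈y∷zs)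

  sorted-∈-after : ∀ xs {x y ys} → AllPairs _<_ (xs ++ x ∷ ys) → y ∈ xs ++ x ∷ ys → x < y → y ∈ ys
  sorted-∈-after [] _ (here refl) x<y = ⊥-elim (<-irrefl refl x<y)
  sorted-∈-after [] _ (there y∈ys) _ = y∈ys
  sorted-∈-after (z ∷ xs) (z<xs++x∷ys ∷ _) (here refl) x<y =
    ⊥-elim (<-asym x<y (All.lookup z<xs++x∷ys (∈-++⁺ʳ xs (here refl))))
  sorted-∈-after (z ∷ xs) (_ ∷ sorted) (there y∈) x<y = sorted-∈-after xs sorted y∈ x<y

  Rec-∷⁻ : ∀ {a b : ℤ} {x xs} → Rec a b (x ∷ xs) → Rec a b xs
  Rec-∷⁻ {xs = []} _ = tt
  Rec-∷⁻ {xs = _ ∷ []} _ = tt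
  Rec-∷⁻ {xs = _ ∷ _ ∷ _} (_ , rec) = rec

  Rec-++⁻ : ∀ {a b : ℤ} xs {ys} → Rec a b (xs ++ ys) → Rec a b ys
  Rec-++⁻ [] rec = rec
  Rec-++⁻ (_ ∷ xs) rec = Rec-++⁻ xs (Rec-∷⁻ rec)

module Diophantine where

  open import Data.Nat
  open import Data.Nat.Properties
  open import Data.Nat.Tactic.RingSolver using (solve-∀)
  open import Data.Product using (_×_; _,_; ∃)
  open import Data.Empty using (⊥; ⊥-elim)
  open import Data.Unit using (tt)
  open import Relation.Nullary using (Dec; yes; no)
  open import Relation.Nullary.Decidable using (from-no)
  open import Relation.Binary.PropositionalEquality

  -- K (q + β³ + 3Aβp) = K A³ p, after substituting Kq = p + Aβ and A² = Kp + β.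
  Reduced : ℕ → ℕ → ℕ → ℕ → Set
  Reduced A β K p = p + K * (β * β * β) + A * β + 2 * (A * β * (K * p)) ≡ A * ((K * p) * (K * p))

  reduced : ∀ A β K p q → A * A ≡ K * p + β → p + A * β ≡ K * q →
            q + β * β * β + 3 * (A * β * p) ≡ A * A * A * p → Reduced A β K p
  reduced A β K p q A²≡X+β p+Aβ≡Kq cubic = +-cancelʳ-≡ (A * β * X) _ _ (begin
    p + K * (β * β * β) + A * β + 2 * (A * β * X) + A * β * X ≡⟨ regroup A β K p ⟩
    p + A * β + K * (β * β * β) + 3 * (A * β * X)             ≡⟨ cong (λ z → z + K * (β * β * β) + 3 * (A * β * X)) p+Aβ≡Kq ⟩
    K * q + K * (β * β * β) + 3 * (A * β * X)                 ≡⟨ factor A β K p q ⟩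
    K * (q + β * β * β + 3 * (A * β * p))                     ≡⟨ cong (K *_) cubic ⟩
    K * (A * A * A * p)                                       ≡⟨ reorder A K p ⟩
    A * (A * A) * X                                           ≡⟨ cong (λ z → A * z * X) A²≡X+β ⟩
    A * (X + β) * X                                           ≡⟨ expand A β X ⟩
    A * (X * X) + A * β * X                                   ∎)
    where
    open ≡-Reasoning
    X : ℕ
    X = K * p
    regroup : ∀ A β K p → p + K * (β * β * β) + A * β + 2 * (A * β * (K * p)) + A * β * (K * p)
                        ≡ p + A * β + K * (β * β * β) + 3 * (A * β * (K * p))
    regroup = solve-∀
    factor : ∀ A β K p q → K * q + K * (β * β * β) + 3 * (A * β * (K * p)) ≡ K * (q + β * β * β + 3 * (A * β * p))
    factor = solve-∀
    reorder : ∀ A K p → K * (A * A * A * p) ≡ A * (A * A) * (K * p)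
    reorder = solve-∀
    expand : ∀ A β X → A * (X + β) * X ≡ A * (X * X) + A * β * X
    expand = solve-∀

  m+c≡m*c+1+n⇒c≡1 : ∀ {m c n} → 2 ≤ m → 1 ≤ c → m + c ≡ m * c + 1 + n → c ≡ 1 × n ≡ 0
  m+c≡m*c+1+n⇒c≡1 {suc zero} (s≤s ()) _ _
  m+c≡m*c+1+n⇒c≡1 {suc (suc m)} {suc c} {n} _ _ eq =
    cong suc (m+n≡0⇒m≡0 c (m+n≡0⇒m≡0 (c + m * c) excess≡0)) , m+n≡0⇒n≡0 (c + m * c) excess≡0
    where
    split : ∀ m c n → (2 + m) * (1 + c) + 1 + n ≡ (2 + m + (1 + c)) + (c + m * c + n)
    split = solve-∀
    excess≡0 : c + m * c + n ≡ 0
    excess≡0 = +-cancelˡ-≡ (2 + m + (1 + c)) _ 0 (trans (sym (trans eq (split m c n))) (sym (+-identityʳ _)))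

  reduced-A>β : ∀ β e K p → 1 ≤ β → 1 ≤ K → 2 ≤ p → K * p + β ≡ (1 + β + e) * (1 + β + e) →
                Reduced (1 + β + e) β K p → e ≡ 0 × K ≡ 1 × β ≡ 1
  reduced-A>β β e K p 1≤β 1≤K 2≤p X+β≡A² red with m+c≡m*c+1+n⇒c≡1 2≤p 1≤Kβ³ p+Kβ³≡pKβ³+1+eG
    where
    A : ℕ
    A = 1 + β + e
    -- Solving X + β = A² for X = K p turns Reduced into p + K β³ = p (K β³) + 1 + e G.
    X : ℕ
    X = β * β + β + 1 + 2 * e * (1 + β) + e * e
    G : ℕ
    G = 1 + (X * (A * A + β * β + A * β + 2 + e) + A)
    K*p≡X : K * p ≡ X
    K*p≡X = +-cancelʳ-≡ β _ _ (trans X+β≡A² (square β e))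
      where
      square : ∀ β e → (1 + β + e) * (1 + β + e) ≡ β * β + β + 1 + 2 * e * (1 + β) + e * e + β
      square = solve-∀
    identity : ∀ β e → (β * β + β + 1 + 2 * e * (1 + β) + e * e) * (β * β * β) + 1
        + e * (1 + ((β * β + β + 1 + 2 * e * (1 + β) + e * e) * ((1 + β + e) * (1 + β + e) + β * β + (1 + β + e) * β + 2 + e) + (1 + β + e)))
        + ((1 + β + e) * β + 2 * ((1 + β + e) * β * (β * β + β + 1 + 2 * e * (1 + β) + e * e)))
      ≡ (1 + β + e) * ((β * β + β + 1 + 2 * e * (1 + β) + e * e) * (β * β + β + 1 + 2 * e * (1 + β) + e * e))
    identity = solve-∀
    p+Kβ³≡pKβ³+1+eG : p + K * (β * β * β) ≡ p * (K * (β * β * β)) + 1 + e * G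
    p+Kβ³≡pKβ³+1+eG = +-cancelʳ-≡ (A * β + 2 * (A * β * X)) _ _ (begin
      p + K * (β * β * β) + (A * β + 2 * (A * β * X))  ≡⟨ sym (+-assoc (p + K * (β * β * β)) (A * β) _) ⟩
      p + K * (β * β * β) + A * β + 2 * (A * β * X)    ≡⟨ subst (λ Y → p + K * (β * β * β) + A * β + 2 * (A * β * Y) ≡ A * (Y * Y)) K*p≡X red ⟩
      A * (X * X)                                       ≡⟨ sym (identity β e) ⟩
      X * (β * β * β) + 1 + e * G + (A * β + 2 * (A * β * X)) ≡⟨ cong (λ z → z * (β * β * β) + 1 + e * G + (A * β + 2 * (A * β * X))) (sym K*p≡X) ⟩
      K * p * (β * β * β) + 1 + e * G + (A * β + 2 * (A * β * X)) ≡⟨ cong (λ z → z + 1 + e * G + (A * β + 2 * (A * β * X))) (reassoc K p (β * β * β)) ⟩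
      p * (K * (β * β * β)) + 1 + e * G + (A * β + 2 * (A * β * X)) ∎)
      where
      open ≡-Reasoning
      reassoc : ∀ K p c → K * p * c ≡ p * (K * c)
      reassoc = solve-∀
    1≤Kβ³ : 1 ≤ K * (β * β * β)
    1≤Kβ³ = *-mono-≤ 1≤K (*-mono-≤ (*-mono-≤ 1≤β 1≤β) 1≤β)
  ... | Kβ³≡1 , eG≡0 = m*n≡0⇒m≡0 e _ eG≡0 , m*n≡1⇒m≡1 K _ Kβ³≡1 , m*n≡1⇒n≡1 (β * β) β (m*n≡1⇒n≡1 K _ Kβ³≡1)

  Dominates : ℕ → ℕ → ℕ → Set
  Dominates A β X = X * β * β + 2 * A * β * X + A * β + X ≤ A * (X * X)

  reduced⇒p≤β : ∀ A β K p → 1 ≤ β → 1 ≤ K → Reduced A β K p → Dominates A β (K * p) → p ≤ β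
  reduced⇒p≤β A β K p 1≤β 1≤K red dom = *-cancelˡ-≤ (K * β * β) {{>-nonZero Kβ²>0}} (begin
    K * β * β * p       ≡⟨ reorder K β p ⟩
    X * β * β           ≤⟨ +-cancelʳ-≤ X _ _ Xβ²+X≤X+Kβ³ ⟩
    K * (β * β * β)     ≡⟨ cube K β ⟩
    K * β * β * β       ∎)
    where
    open ≤-Reasoning
    X : ℕ
    X = K * p
    Kβ²>0 : 0 < K * β * β
    Kβ²>0 = *-mono-≤ (*-mono-≤ 1≤K 1≤β) 1≤β
    reorder : ∀ K β p → K * β * β * p ≡ K * p * β * β
    reorder = solve-∀
    cube : ∀ K β → K * (β * β * β) ≡ K * β * β * β
    cube = solve-∀
    regroup : ∀ A β X → X * β * β + 2 * A * β * X + A * β + X ≡ X * β * β + X + (A * β + 2 * (A * β * X))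
    regroup = solve-∀
    Xβ²+X≤p+Kβ³ : X * β * β + X ≤ p + K * (β * β * β)
    Xβ²+X≤p+Kβ³ = +-cancelʳ-≤ (A * β + 2 * (A * β * X)) _ _ (begin
      X * β * β + X + (A * β + 2 * (A * β * X))   ≡⟨ regroup A β X ⟨
      X * β * β + 2 * A * β * X + A * β + X       ≤⟨ dom ⟩
      A * (X * X)                                 ≡⟨ red ⟨
      p + K * (β * β * β) + A * β + 2 * (A * β * X) ≡⟨ +-assoc (p + K * (β * β * β)) (A * β) _ ⟩
      p + K * (β * β * β) + (A * β + 2 * (A * β * X)) ∎)
    Xβ²+X≤X+Kβ³ : X * β * β + X ≤ K * (β * β * β) + X
    Xβ²+X≤X+Kβ³ = begin
      X * β * β + X        ≤⟨ Xβ²+X≤p+Kβ³ ⟩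
      p + K * (β * β * β)  ≤⟨ +-monoˡ-≤ _ (m≤n*m p K {{>-nonZero 1≤K}}) ⟩
      X + K * (β * β * β)  ≡⟨ +-comm X _ ⟩
      K * (β * β * β) + X  ∎

  3d≤2A : ∀ A d → (A + d) * (2 + d) < A * A → 3 * d ≤ 2 * A
  3d≤2A A d β[d+2]<A² with 3 * d ≤? 2 * A
  ... | yes 3d≤2A = 3d≤2A
  ... | no 3d≰2A = ⊥-elim (<⇒≱ (*-monoʳ-< 9 β[d+2]<A²) (begin
    9 * (A * A)                                    ≤⟨ m≤m+n (9 * (A * A)) (A * A + 37 * A + 7) ⟩
    9 * (A * A) + (A * A + 37 * A + 7)             ≡⟨ expand A ⟨
    (3 * A + (1 + 2 * A)) * ((1 + 2 * A) + 6)      ≤⟨ *-mono-≤ (+-monoʳ-≤ (3 * A) 2A<3d) (+-monoˡ-≤ 6 2A<3d) ⟩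
    (3 * A + 3 * d) * (3 * d + 6)                  ≡⟨ factor A d ⟩
    9 * ((A + d) * (2 + d))                        ∎))
    where
    open ≤-Reasoning
    2A<3d : 1 + 2 * A ≤ 3 * d
    2A<3d = ≰⇒> 3d≰2A
    expand : ∀ A → (3 * A + (1 + 2 * A)) * ((1 + 2 * A) + 6) ≡ 9 * (A * A) + (A * A + 37 * A + 7)
    expand = solve-∀
    factor : ∀ A d → (3 * A + 3 * d) * (3 * d + 6) ≡ 9 * ((A + d) * (2 + d))
    factor = solve-∀

  70A²+36≤9A³ : ∀ A → 8 ≤ A → 70 * (A * A) + 36 ≤ 9 * (A * A * A)
  70A²+36≤9A³ A 8≤A with m≤n⇒∃[o]m+o≡n 8≤A
  ... | m , refl = subst (70 * ((8 + m) * (8 + m)) + 36 ≤_) (sym (split m)) (m≤m+n _ _)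
    where
    split : ∀ m → 9 * ((8 + m) * (8 + m) * (8 + m)) ≡ 70 * ((8 + m) * (8 + m)) + 36 + (92 + 608 * m + 146 * (m * m) + 9 * (m * m * m))
    split = solve-∀

  dominates-large : ∀ A β X → 8 ≤ A → 3 * β ≤ 5 * A → X + β ≡ A * A → Dominates A β X
  dominates-large A β X 8≤A 3β≤5A X+β≡A² = begin
    X * β * β + 2 * A * β * X + A * β + X        ≤⟨ +-monoˡ-≤ X (+-monoʳ-≤ (X * β * β + 2 * A * β * X) Aβ≤3X) ⟩
    X * β * β + 2 * A * β * X + 3 * X + X        ≡⟨ regroup A β X ⟩
    X * (β * β + 2 * A * β + 4)                  ≤⟨ *-monoʳ-≤ X β²+2Aβ+4≤AX ⟩
    X * (A * X)                                  ≡⟨ reorder A X ⟩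
    A * (X * X)                                  ∎
    where
    open ≤-Reasoning
    regroup : ∀ A β X → X * β * β + 2 * A * β * X + 3 * X + X ≡ X * (β * β + 2 * A * β + 4)
    regroup = solve-∀
    reorder : ∀ A X → X * (A * X) ≡ A * (X * X)
    reorder = solve-∀
    AX+Aβ≡A³ : A * X + A * β ≡ A * A * A
    AX+Aβ≡A³ = trans (sym (*-distribˡ-+ A X β)) (trans (cong (A *_) X+β≡A²) (sym (*-assoc A A A)))
    β²+3Aβ+4≤A³ : β * β + 3 * A * β + 4 ≤ A * A * A
    β²+3Aβ+4≤A³ = *-cancelˡ-≤ 9 (begin
      9 * (β * β + 3 * A * β + 4)               ≡⟨ scale A β ⟩
      3 * β * (3 * β) + 9 * A * (3 * β) + 36    ≤⟨ +-monoˡ-≤ 36 (+-mono-≤ (*-mono-≤ 3β≤5A 3β≤5A) (*-monoʳ-≤ (9 * A) 3β≤5A)) ⟩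
      5 * A * (5 * A) + 9 * A * (5 * A) + 36    ≡⟨ collect A ⟩
      70 * (A * A) + 36                         ≤⟨ 70A²+36≤9A³ A 8≤A ⟩
      9 * (A * A * A)                           ∎)
      where
      scale : ∀ A β → 9 * (β * β + 3 * A * β + 4) ≡ 3 * β * (3 * β) + 9 * A * (3 * β) + 36
      scale = solve-∀
      collect : ∀ A → 5 * A * (5 * A) + 9 * A * (5 * A) + 36 ≡ 70 * (A * A) + 36
      collect = solve-∀
    β²+2Aβ+4≤AX : β * β + 2 * A * β + 4 ≤ A * X
    β²+2Aβ+4≤AX = +-cancelʳ-≤ (A * β) _ _ (begin
      β * β + 2 * A * β + 4 + A * β   ≡⟨ shift A β ⟩
      β * β + 3 * A * β + 4           ≤⟨ β²+3Aβ+4≤A³ ⟩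
      A * A * A                       ≡⟨ AX+Aβ≡A³ ⟨
      A * X + A * β                   ∎)
      where
      shift : ∀ A β → β * β + 2 * A * β + 4 + A * β ≡ β * β + 3 * A * β + 4
      shift = solve-∀
    Aβ≤3X : A * β ≤ 3 * X
    Aβ≤3X = +-cancelʳ-≤ (3 * β) _ _ (*-cancelˡ-≤ 3 (begin
      3 * (A * β + 3 * β)               ≡⟨ scale A β ⟩
      A * (3 * β) + 3 * (3 * β)         ≤⟨ +-mono-≤ (*-monoʳ-≤ A 3β≤5A) (*-monoʳ-≤ 3 3β≤5A) ⟩
      A * (5 * A) + 3 * (5 * A)         ≤⟨ +-monoʳ-≤ (A * (5 * A)) (≤-trans (≤-reflexive (sym (*-assoc 3 5 A))) (*-monoˡ-≤ A 15≤4A)) ⟩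
      A * (5 * A) + 4 * A * A           ≡⟨ collect A ⟩
      3 * (3 * (A * A))                 ≡⟨ cong (λ z → 3 * (3 * z)) X+β≡A² ⟨
      3 * (3 * (X + β))                 ≡⟨ cong (3 *_) (*-distribˡ-+ 3 X β) ⟩
      3 * (3 * X + 3 * β)               ∎))
      where
      scale : ∀ A β → 3 * (A * β + 3 * β) ≡ A * (3 * β) + 3 * (3 * β)
      scale = solve-∀
      collect : ∀ A → A * (5 * A) + 4 * A * A ≡ 3 * (3 * (A * A))
      collect = solve-∀
      15≤4A : 15 ≤ 4 * A
      15≤4A = ≤-trans (≤ᵇ⇒≤ 15 32 _) (*-monoʳ-≤ 4 8≤A)

  β[1+d]<p : ∀ A d K p → K * p + (A + d) ≡ A * A →
             A * (p + A * (A + d)) + (A + d) * (A + d) * (K * p) < K * p * (p + A * (A + d)) →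
             (A + d) * (1 + d) < p
  β[1+d]<p A d K p X+β≡A² tight with (A + d) * (1 + d) <? p
  ... | yes β[1+d]<p = β[1+d]<p
  ... | no β[1+d]≮p = ⊥-elim (<⇒≱ tight (begin
    X * (p + A * β)                 ≤⟨ *-monoʳ-≤ X (+-monoˡ-≤ (A * β) (≮⇒≥ β[1+d]≮p)) ⟩
    X * (β * (1 + d) + A * β)       ≡⟨ expand X A d ⟩
    β * β * X + X * β               ≤⟨ +-monoʳ-≤ (β * β * X) Xβ≤A[p+Aβ] ⟩
    β * β * X + A * (p + A * β)     ≡⟨ +-comm (β * β * X) _ ⟩
    A * (p + A * β) + β * β * X     ∎))
    where
    open ≤-Reasoning
    β : ℕ
    β = A + d
    X : ℕ
    X = K * p
    expand : ∀ X A d → X * ((A + d) * (1 + d) + A * (A + d)) ≡ (A + d) * (A + d) * X + X * (A + d)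
    expand = solve-∀
    Xβ≤A[p+Aβ] : X * β ≤ A * (p + A * β)
    Xβ≤A[p+Aβ] = begin
      X * β              ≤⟨ m≤m+n (X * β) (β * β) ⟩
      X * β + β * β      ≡⟨ *-distribʳ-+ β X β ⟨
      (X + β) * β        ≡⟨ cong (_* β) X+β≡A² ⟩
      A * A * β          ≡⟨ *-assoc A A β ⟩
      A * (A * β)        ≤⟨ *-monoʳ-≤ A (m≤n+m (A * β) p) ⟩
      A * (p + A * β)    ∎

  β[2+d]<A² : ∀ A d K p → 1 ≤ K → (A + d) * (1 + d) < p → K * p + (A + d) ≡ A * A → (A + d) * (2 + d) < A * A
  β[2+d]<A² A d K p 1≤K β[1+d]<p X+β≡A² = begin-strict
    (A + d) * (2 + d)          ≡⟨ *-distribˡ-+ (A + d) 1 (1 + d) ⟩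
    (A + d) * 1 + (A + d) * (1 + d) ≡⟨ +-comm ((A + d) * 1) _ ⟩
    (A + d) * (1 + d) + (A + d) * 1 <⟨ +-mono-<-≤ β[1+d]<p (≤-reflexive (*-identityʳ (A + d))) ⟩
    p + (A + d)                ≤⟨ +-monoˡ-≤ (A + d) (m≤n*m p K {{>-nonZero 1≤K}}) ⟩
    K * p + (A + d)            ≡⟨ X+β≡A² ⟩
    A * A                      ∎
    where open ≤-Reasoning

  d≤2 : ∀ A d → A ≤ 7 → (A + d) * (2 + d) < A * A → d ≤ 2
  d≤2 A d A≤7 β[2+d]<A² with d ≤? 2
  ... | yes d≤2 = d≤2
  ... | no d≰2 = ⊥-elim (<⇒≱ β[2+d]<A² (begin
    A * A            ≤⟨ *-monoˡ-≤ A A≤7 ⟩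
    7 * A            ≡⟨ split A ⟩
    5 * A + 2 * A    ≤⟨ +-monoʳ-≤ (5 * A) (*-monoʳ-≤ 2 A≤7) ⟩
    5 * A + 14       <⟨ n<1+n _ ⟩
    1 + (5 * A + 14) ≡⟨ times5 A ⟨
    (A + 3) * 5      ≤⟨ *-mono-≤ (+-monoʳ-≤ A 3≤d) (+-monoʳ-≤ 2 3≤d) ⟩
    (A + d) * (2 + d) ∎))
    where
    open ≤-Reasoning
    3≤d : 3 ≤ d
    3≤d = ≰⇒> d≰2
    split : ∀ A → 7 * A ≡ 5 * A + 2 * A
    split = solve-∀
    times5 : ∀ A → (A + 3) * 5 ≡ 1 + (5 * A + 14)
    times5 = solve-∀

  reduced-3-3 : ∀ K p → K * p ≡ 6 → Reduced 3 3 K p → ⊥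
  reduced-3-3 K p X≡6 red = <⇒≱ (≤ᵇ⇒≤ 109 117 tt) (begin
    117                     ≤⟨ +-monoˡ-≤ 108 (m≤n+m 9 (p + K * 27)) ⟩
    p + K * 27 + 9 + 108    ≡⟨ subst (λ X → p + K * 27 + 9 + 2 * (9 * X) ≡ 3 * (X * X)) X≡6 red ⟩
    108                     ∎)
    where open ≤-Reasoning

  reduced-4-4 : ∀ K p → 5 ≤ p → K * p ≡ 12 → Reduced 4 4 K p → ⊥
  reduced-4-4 K p 5≤p X≡12 red =
    no-solution K X≡12 (subst (λ X → p + K * 64 + 16 + 2 * (16 * X) ≡ 4 * (X * X)) X≡12 red)
    where
    no-solution : ∀ K → K * p ≡ 12 → p + K * 64 + 16 + 384 ≡ 576 → ⊥
    no-solution 0 () _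
    no-solution 1 X≡12 eq =
      from-no (12 + 64 + 16 + 384 ≟ 576) (subst (λ p → p + 64 + 16 + 384 ≡ 576) (trans (sym (+-identityʳ p)) X≡12) eq)
    no-solution 2 X≡12 eq = from-no (2 * 48 ≟ 12) (trans (sym (cong (2 *_) p≡48)) X≡12)
      where
      p≡48 : p ≡ 48
      p≡48 = +-cancelʳ-≡ 128 _ _ (+-cancelʳ-≡ 16 _ _ (+-cancelʳ-≡ 384 _ _ eq))
    no-solution K@(suc (suc (suc _))) X≡12 _ =
      <⇒≱ (≤ᵇ⇒≤ 13 15 tt) (≤-trans (*-mono-≤ {3} {K} (s≤s (s≤s (s≤s z≤n))) 5≤p) (≤-reflexive X≡12))

  reduced-5-6 : ∀ K p → 13 ≤ p → K * p ≡ 19 → Reduced 5 6 K p → ⊥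
  reduced-5-6 K p 13≤p X≡19 red =
    no-solution K X≡19 (subst (λ X → p + K * 216 + 30 + 2 * (30 * X) ≡ 5 * (X * X)) X≡19 red)
    where
    no-solution : ∀ K → K * p ≡ 19 → p + K * 216 + 30 + 1140 ≡ 1805 → ⊥
    no-solution 0 () _
    no-solution 1 X≡19 eq =
      from-no (19 + 216 + 30 + 1140 ≟ 1805) (subst (λ p → p + 216 + 30 + 1140 ≡ 1805) (trans (sym (+-identityʳ p)) X≡19) eq)
    no-solution K@(suc (suc _)) X≡19 _ =
      <⇒≱ (≤ᵇ⇒≤ 20 26 tt) (≤-trans (*-mono-≤ {2} {K} (s≤s (s≤s z≤n)) 13≤p) (≤-reflexive X≡19))

  reduced-4-5 : ∀ K p → 1 ≤ K → K * p ≡ 11 → Reduced 4 5 K p → ⊥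
  reduced-4-5 K p 1≤K X≡11 red = <⇒≱ (≤ᵇ⇒≤ 485 585 tt) (begin
    585                          ≤⟨ +-monoˡ-≤ 440 (+-monoˡ-≤ 20 (≤-trans (m≤n+m 125 p) (+-monoʳ-≤ p (*-monoˡ-≤ 125 1≤K)))) ⟩
    p + K * 125 + 20 + 440       ≡⟨ subst (λ X → p + K * 125 + 20 + 2 * (20 * X) ≡ 4 * (X * X)) X≡11 red ⟩
    484                          ∎)
    where open ≤-Reasoning

  dominated⇒¬reduced : ∀ A β K p X → 1 ≤ β → 1 ≤ K → β < p → K * p + β ≡ X + β →
                Dominates A β X → Reduced A β K p → ⊥
  dominated⇒¬reduced A β K p X 1≤β 1≤K β<p Kp+β≡X+β dom red =
    <⇒≱ β<p (reduced⇒p≤β A β K p 1≤β 1≤K red (subst (Dominates A β) (sym (+-cancelʳ-≡ β _ _ Kp+β≡X+β)) dom))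

  -- Each (A, d) either violates the bound β (2 + d) < A², satisfies Dominates numerically, or is one of
  -- the four cases above.
  reduced-small : ∀ A d K p → A ≤ 7 → d ≤ 2 → 1 ≤ K → (A + d) * (1 + d) < p →
                  K * p + (A + d) ≡ A * A → (A + d) * (2 + d) < A * A → Reduced A (A + d) K p → ⊥
  reduced-small 0 0 _ _ _ _ _ _ _ C _ = <⇒≱ C (≤ᵇ⇒≤ _ _ tt)
  reduced-small 0 1 _ _ _ _ _ _ _ C _ = <⇒≱ C (≤ᵇ⇒≤ _ _ tt)
  reduced-small 0 2 _ _ _ _ _ _ _ C _ = <⇒≱ C (≤ᵇ⇒≤ _ _ tt)
  reduced-small 1 0 _ _ _ _ _ _ _ C _ = <⇒≱ C (≤ᵇ⇒≤ _ _ tt)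
  reduced-small 1 1 _ _ _ _ _ _ _ C _ = <⇒≱ C (≤ᵇ⇒≤ _ _ tt)
  reduced-small 1 2 _ _ _ _ _ _ _ C _ = <⇒≱ C (≤ᵇ⇒≤ _ _ tt)
  reduced-small 2 0 _ _ _ _ _ _ _ C _ = <⇒≱ C (≤ᵇ⇒≤ _ _ tt)
  reduced-small 2 1 _ _ _ _ _ _ _ C _ = <⇒≱ C (≤ᵇ⇒≤ _ _ tt)
  reduced-small 2 2 _ _ _ _ _ _ _ C _ = <⇒≱ C (≤ᵇ⇒≤ _ _ tt)
  reduced-small 3 0 K p _ _ _ _ X+β≡A² _ red = reduced-3-3 K p (+-cancelʳ-≡ 3 _ 6 X+β≡A²) red
  reduced-small 3 1 _ _ _ _ _ _ _ C _ = <⇒≱ C (≤ᵇ⇒≤ _ _ tt)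
  reduced-small 3 2 _ _ _ _ _ _ _ C _ = <⇒≱ C (≤ᵇ⇒≤ _ _ tt)
  reduced-small 4 0 K p _ _ _ 4<p X+β≡A² _ red = reduced-4-4 K p 4<p (+-cancelʳ-≡ 4 _ 12 X+β≡A²) red
  reduced-small 4 1 K p _ _ 1≤K _ X+β≡A² _ red = reduced-4-5 K p 1≤K (+-cancelʳ-≡ 5 _ 11 X+β≡A²) red
  reduced-small 4 2 _ _ _ _ _ _ _ C _ = <⇒≱ C (≤ᵇ⇒≤ _ _ tt)
  reduced-small 5 0 K p _ _ 1≤K β<p X+β≡A² _ red = dominated⇒¬reduced 5 5 K p 20 (s≤s z≤n) 1≤K β<p X+β≡A² (≤ᵇ⇒≤ _ _ tt) red
  reduced-small 5 1 K p _ _ _ 12<p X+β≡A² _ red = reduced-5-6 K p 12<p (+-cancelʳ-≡ 6 _ 19 X+β≡A²) red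
  reduced-small 5 2 _ _ _ _ _ _ _ C _ = <⇒≱ C (≤ᵇ⇒≤ _ _ tt)
  reduced-small 6 0 K p _ _ 1≤K β<p X+β≡A² _ red = dominated⇒¬reduced 6 6 K p 30 (s≤s z≤n) 1≤K β<p X+β≡A² (≤ᵇ⇒≤ _ _ tt) red
  reduced-small 6 1 K p _ _ 1≤K 14<p X+β≡A² _ red = dominated⇒¬reduced 6 7 K p 29 (s≤s z≤n) 1≤K (≤-trans (≤ᵇ⇒≤ 8 15 tt) 14<p) X+β≡A² (≤ᵇ⇒≤ _ _ tt) red
  reduced-small 6 2 K p _ _ 1≤K 24<p X+β≡A² _ red = dominated⇒¬reduced 6 8 K p 28 (s≤s z≤n) 1≤K (≤-trans (≤ᵇ⇒≤ 9 25 tt) 24<p) X+β≡A² (≤ᵇ⇒≤ _ _ tt) red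
  reduced-small 7 0 K p _ _ 1≤K β<p X+β≡A² _ red = dominated⇒¬reduced 7 7 K p 42 (s≤s z≤n) 1≤K β<p X+β≡A² (≤ᵇ⇒≤ _ _ tt) red
  reduced-small 7 1 K p _ _ 1≤K 16<p X+β≡A² _ red = dominated⇒¬reduced 7 8 K p 41 (s≤s z≤n) 1≤K (≤-trans (≤ᵇ⇒≤ 9 17 tt) 16<p) X+β≡A² (≤ᵇ⇒≤ _ _ tt) red
  reduced-small 7 2 K p _ _ 1≤K 27<p X+β≡A² _ red = dominated⇒¬reduced 7 9 K p 40 (s≤s z≤n) 1≤K (≤-trans (≤ᵇ⇒≤ 10 28 tt) 27<p) X+β≡A² (≤ᵇ⇒≤ _ _ tt) red
  reduced-small _ (suc (suc (suc _))) _ _ _ (s≤s (s≤s ())) _ _ _ _ _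
  reduced-small (suc (suc (suc (suc (suc (suc (suc (suc _)))))))) _ _ _ (s≤s (s≤s (s≤s (s≤s (s≤s (s≤s (s≤s ()))))))) _ _ _ _ _ _

  tail-inequality : ∀ A β K p q s t → 1 ≤ K → 1 ≤ p → K * p + β ≡ A * A →
                    t + β * (p * p) ≡ A * s → p * q + β * s ≡ A * t → t < p * q →
                    A * q + β * β * p < K * p * q
  tail-inequality A β K p q s t 1≤K 1≤p X+β≡A² e6 e7 t<pq = *-cancelˡ-< p _ _ (begin-strict
    p * (A * q + β * β * p)       ≡⟨ distribute p A q β ⟩
    A * (p * q) + β * β * (p * p) ≡⟨ Xt≡ ⟨
    X * t                         <⟨ *-monoʳ-< X {{>-nonZero 1≤X}} t<pq ⟩
    X * (p * q)                   ≡⟨ reorder K p q ⟩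
    p * (K * p * q)               ∎)
    where
    open ≤-Reasoning
    X : ℕ
    X = K * p
    1≤X : 1 ≤ X
    1≤X = *-mono-≤ 1≤K 1≤p
    distribute : ∀ p A q β → p * (A * q + β * β * p) ≡ A * (p * q) + β * β * (p * p)
    distribute = solve-∀
    reorder : ∀ K p q → K * p * (p * q) ≡ p * (K * p * q)
    reorder = solve-∀
    Xt≡ : X * t ≡ A * (p * q) + β * β * (p * p)
    Xt≡ = +-cancelʳ-≡ (β * t) _ _ (begin-equality
      X * t + β * t                          ≡⟨ *-distribʳ-+ t X β ⟨
      (X + β) * t                            ≡⟨ cong (_* t) X+β≡A² ⟩
      A * A * t                              ≡⟨ *-assoc A A t ⟩
      A * (A * t)                            ≡⟨ cong (A *_) e7 ⟨
      A * (p * q + β * s)                    ≡⟨ *-distribˡ-+ A (p * q) (β * s) ⟩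
      A * (p * q) + A * (β * s)              ≡⟨ cong (A * (p * q) +_) (x*[y*z]≡y*[x*z] A β s) ⟩
      A * (p * q) + β * (A * s)              ≡⟨ cong (λ z → A * (p * q) + β * z) e6 ⟨
      A * (p * q) + β * (t + β * (p * p))    ≡⟨ expand A β p q t ⟩
      A * (p * q) + β * β * (p * p) + β * t  ∎)
      where
      x*[y*z]≡y*[x*z] : ∀ x y z → x * (y * z) ≡ y * (x * z)
      x*[y*z]≡y*[x*z] = solve-∀
      expand : ∀ A β p q t → A * (p * q) + β * (t + β * (p * p)) ≡ A * (p * q) + β * β * (p * p) + β * t
      expand = solve-∀

  ¬reduced-A≤β : ∀ A d K p q → 1 ≤ A + d → 1 ≤ K → K * p + (A + d) ≡ A * A → p + A * (A + d) ≡ K * q →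
                  A * q + (A + d) * (A + d) * p < K * p * q → Reduced A (A + d) K p → ⊥
  ¬reduced-A≤β A d K p q 1≤β 1≤K X+β≡A² p+Aβ≡Kq ineq red = by-size (8 ≤? A)
    where
    β : ℕ
    β = A + d
    tight : A * (p + A * β) + β * β * (K * p) < K * p * (p + A * β)
    tight = begin-strict
      A * (p + A * β) + β * β * (K * p)   ≡⟨ cong (λ z → A * z + β * β * (K * p)) p+Aβ≡Kq ⟩
      A * (K * q) + β * β * (K * p)       ≡⟨ factor A β K p q ⟩
      K * (A * q + β * β * p)             <⟨ *-monoʳ-< K {{>-nonZero 1≤K}} ineq ⟩
      K * (K * p * q)                     ≡⟨ reorder K p q ⟩
      K * p * (K * q)                     ≡⟨ cong (K * p *_) p+Aβ≡Kq ⟨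
      K * p * (p + A * β)                 ∎
      where
      open ≤-Reasoning
      factor : ∀ A β K p q → A * (K * q) + β * β * (K * p) ≡ K * (A * q + β * β * p)
      factor = solve-∀
      reorder : ∀ K p q → K * (K * p * q) ≡ K * p * (K * q)
      reorder = solve-∀
    lower-bound : β * (1 + d) < p
    lower-bound = β[1+d]<p A d K p X+β≡A² tight
    C : β * (2 + d) < A * A
    C = β[2+d]<A² A d K p 1≤K lower-bound X+β≡A²
    by-size : Dec (8 ≤ A) → ⊥
    by-size (yes 8≤A) = dominated⇒¬reduced A β K p (K * p) 1≤β 1≤K (≤-<-trans (m≤m*n β (1 + d)) lower-bound) refl
                          (dominates-large A β (K * p) 8≤A 3β≤5A X+β≡A²) red
      where
      3β≤5A : 3 * β ≤ 5 * A
      3β≤5A = begin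
        3 * (A + d)      ≡⟨ *-distribˡ-+ 3 A d ⟩
        3 * A + 3 * d    ≤⟨ +-monoʳ-≤ (3 * A) (3d≤2A A d C) ⟩
        3 * A + 2 * A    ≡⟨ *-distribʳ-+ A 3 2 ⟨
        5 * A            ∎
        where open ≤-Reasoning
    by-size (no 8≰A) = reduced-small A d K p A≤7 (d≤2 A d A≤7 C) 1≤K lower-bound X+β≡A² C red
      where
      A≤7 : A ≤ 7
      A≤7 = ≤-pred (≰⇒> 8≰A)

  unique-solution : ∀ A β K p q s t → 1 ≤ β → 1 ≤ K → 2 ≤ p →
                 A * A ≡ K * p + β → p + A * β ≡ K * q → q + β * β * β + 3 * (A * β * p) ≡ A * A * A * p →
                 t + β * (p * p) ≡ A * s → p * q + β * s ≡ A * t → t < p * q → A ≡ 2 × β ≡ 1 × p ≡ 3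
  unique-solution A β K p q s t 1≤β 1≤K 2≤p A²≡X+β p+Aβ≡Kq h3 e6 e7 t<pq = by-order (A ≤? β)
    where
    red : Reduced A β K p
    red = reduced A β K p q A²≡X+β p+Aβ≡Kq h3
    A≤β-⊥ : ∃ (λ d → A + d ≡ β) → ⊥
    A≤β-⊥ (d , refl) = ¬reduced-A≤β A d K p q 1≤β 1≤K (sym A²≡X+β) p+Aβ≡Kq
      (tail-inequality A β K p q s t 1≤K (≤-trans (n≤1+n 1) 2≤p) (sym A²≡X+β) e6 e7 t<pq) red
    A>β-solution : ∃ (λ e → suc β + e ≡ A) → A ≡ 2 × β ≡ 1 × p ≡ 3
    A>β-solution (e , refl) = solution (reduced-A>β β e K p 1≤β 1≤K 2≤p (sym A²≡X+β) red)
      where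
      solution : e ≡ 0 × K ≡ 1 × β ≡ 1 → suc β + e ≡ 2 × β ≡ 1 × p ≡ 3
      solution (e≡0 , K≡1 , β≡1) = A≡2 , β≡1 , p≡3
        where
        A≡2 : suc β + e ≡ 2
        A≡2 = cong₂ (λ b e → suc b + e) β≡1 e≡0
        p≡3 : p ≡ 3
        p≡3 = +-cancelʳ-≡ 1 p 3 (begin
          p + 1                       ≡⟨ cong (_+ 1) (*-identityˡ p) ⟨
          1 * p + 1                   ≡⟨ cong₂ (λ k b → k * p + b) K≡1 β≡1 ⟨
          K * p + β                   ≡⟨ A²≡X+β ⟨
          (suc β + e) * (suc β + e)   ≡⟨ cong (λ a → a * a) A≡2 ⟩
          4                           ∎)
          where open ≡-Reasoning
    by-order : Dec (A ≤ β) → A ≡ 2 × β ≡ 1 × p ≡ 3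
    by-order (yes A≤β) = ⊥-elim (A≤β-⊥ (m≤n⇒∃[o]m+o≡n A≤β))
    by-order (no A≰β) = A>β-solution (m≤n⇒∃[o]m+o≡n (≰⇒> A≰β))

module Coefficients where

  open import Data.Integer as ℤ using (ℤ; +_; -[1+_]; _+_; _*_; _-_; -_)
  open import Data.Integer.Properties using (abs-*; pos-*; +-injective; *-cancelʳ-≡)
  import Data.Integer.Properties as ℤ
  open import Data.Integer.Divisibility.Signed
    using (_∣_; ∣ᵤ⇒∣; ∣⇒∣ᵤ; ∣-refl; ∣m∣n⇒∣m+n; ∣m+n∣m⇒∣n; ∣m+n∣n⇒∣m; ∣m⇒∣m*n; ∣n⇒∣m*n)
  open import Data.Integer.Tactic.RingSolver using (solve-∀)
  open import Data.Nat using (ℕ; suc)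
  import Data.Nat as ℕ
  import Data.Nat.Properties as ℕ
  import Data.Nat.Divisibility as ℕ
  open import Data.Nat.Primality using (Prime; euclidsLemma; prime⇒nonZero)
  open import Algebra.Properties.CommutativeSemigroup ℕ.*-commutativeSemigroup using (x∙yz≈y∙xz)
  open import Data.Product using (_×_; _,_; ∃; proj₁; proj₂)
  open import Data.Sum using (_⊎_; [_,_]′)
  import Data.Sum as Sum
  open import Data.Empty using (⊥; ⊥-elim)
  open import Function using (id; _∘_)
  open import Relation.Nullary using (¬_; contradiction)
  open import Relation.Binary.PropositionalEquality
  open Primes using (prime⇒1<p; prime∤larger-prime)
  open Diophantine using (unique-solution)

  prime∣*⇒∣⊎∣ : ∀ {p} m n → Prime p → + p ∣ m * n → (+ p ∣ m) ⊎ (+ p ∣ n)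
  prime∣*⇒∣⊎∣ m n prime-p p∣mn =
    Sum.map ∣ᵤ⇒∣ ∣ᵤ⇒∣ (euclidsLemma ℤ.∣ m ∣ ℤ.∣ n ∣ prime-p (subst (_ ℕ.∣_) (abs-* m n) (∣⇒∣ᵤ p∣mn)))

  module DivisibilityByP (a b : ℤ) {p q r : ℕ} (prime-p : Prime p) (prime-q : Prime q) (prime-r : Prime r)
      (p<q : p ℕ.< q) (q<r : q ℕ.< r)
      (e3 : + r ≡ a * + q + b * + p) (e4 : + (p ℕ.* p) ≡ a * + r + b * + q) where

    private
      P : ℤ
      P = + p

      p∤q : ¬ P ∣ + q
      p∤q p∣q = prime∤larger-prime prime-p prime-q p<q (∣⇒∣ᵤ p∣q)

      p∤r : ¬ P ∣ + r
      p∤r p∣r = prime∤larger-prime prime-p prime-r (ℕ.<-trans p<q q<r) (∣⇒∣ᵤ p∣r)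

      p∣p² : P ∣ + (p ℕ.* p)
      p∣p² = subst (P ∣_) (sym (pos-* p p)) (∣m⇒∣m*n P ∣-refl)


    p²≡[a²+b]q+abp : + (p ℕ.* p) ≡ (a * a + b) * + q + a * b * + p
    p²≡[a²+b]q+abp = trans e4 (trans (cong (λ z → a * z + b * + q) e3) (expand a b (+ q) P))
      where
      expand : ∀ a b q P → a * (a * q + b * P) + b * q ≡ (a * a + b) * q + a * b * P
      expand = solve-∀

    x≡[a²+b]s+abp² : ∀ {s t x} → + t ≡ a * + s + b * + (p ℕ.* p) → + x ≡ a * + t + b * + s →
                     + x ≡ (a * a + b) * + s + a * b * + (p ℕ.* p)
    x≡[a²+b]s+abp² {s} e6 e7 = trans e7 (trans (cong (λ z → a * z + b * + s) e6) (expand a b (+ s) (+ (p ℕ.* p))))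
      where
      expand : ∀ a b s P² → a * (a * s + b * P²) + b * s ≡ (a * a + b) * s + a * b * P²
      expand = solve-∀

    p∤a : ¬ + p ∣ a
    p∤a p∣a = p∤r (subst (P ∣_) (sym e3) (∣m∣n⇒∣m+n (∣m⇒∣m*n (+ q) p∣a) (∣n⇒∣m*n b ∣-refl)))

    p∣a²+b : + p ∣ a * a + b
    p∣a²+b = [ id , (λ p∣q → contradiction p∣q p∤q) ]′ (prime∣*⇒∣⊎∣ (a * a + b) (+ q) prime-p p∣[a²+b]q)
      where
      p∣[a²+b]q : P ∣ (a * a + b) * + q
      p∣[a²+b]q = ∣m+n∣n⇒∣m (subst (P ∣_) p²≡[a²+b]q+abp p∣p²) (∣n⇒∣m*n (a * b) ∣-refl)

    p∤b : ¬ + p ∣ b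
    p∤b p∣b = [ p∤a , p∤a ]′ (prime∣*⇒∣⊎∣ a a prime-p (∣m+n∣n⇒∣m p∣a²+b p∣b))

    p∤s : ∀ {s} → + s ≡ a * + (p ℕ.* p) + b * + r → ¬ p ℕ.∣ s
    p∤s e5 p∣s = [ p∤b , p∤r ]′
      (prime∣*⇒∣⊎∣ b (+ r) prime-p (∣m+n∣m⇒∣n (subst (P ∣_) e5 (∣ᵤ⇒∣ p∣s)) (∣n⇒∣m*n a p∣p²)))

    p∤t : ∀ {s t} → ¬ p ℕ.∣ s → + t ≡ a * + s + b * + (p ℕ.* p) → ¬ p ℕ.∣ t
    p∤t p∤s e6 p∣t = [ p∤a , p∤s ∘ ∣⇒∣ᵤ ]′
      (prime∣*⇒∣⊎∣ a (+ _) prime-p (∣m+n∣n⇒∣m (subst (P ∣_) e6 (∣ᵤ⇒∣ p∣t)) (∣n⇒∣m*n b p∣p²)))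

    p∣x : ∀ {s t x} → + t ≡ a * + s + b * + (p ℕ.* p) → + x ≡ a * + t + b * + s → p ℕ.∣ x
    p∣x {s} e6 e7 = ∣⇒∣ᵤ (subst (P ∣_) (sym (x≡[a²+b]s+abp² e6 e7))
                                 (∣m∣n⇒∣m+n (∣m⇒∣m*n (+ s) p∣a²+b) (∣n⇒∣m*n (a * b) p∣p²)))

  pos-*-cast : ∀ x m y n z → + x + + m * + y ≡ + n * + z → x ℕ.+ m ℕ.* y ≡ n ℕ.* z
  pos-*-cast x m y n z eq = +-injective (begin
    + (x ℕ.+ m ℕ.* y)  ≡⟨ cong (λ w → + x + w) (pos-* m y) ⟩
    + x + + m * + y    ≡⟨ eq ⟩
    + n * + z          ≡⟨ pos-* n z ⟨
    + (n ℕ.* z)        ∎)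
    where open ≡-Reasoning

  move-negʳ : ∀ {x} m y n z → x ≡ m * y + (- n) * z → x + n * z ≡ m * y
  move-negʳ m y n z refl = cancel m y n z
    where
    cancel : ∀ m y n z → m * y + (- n) * z + n * z ≡ m * y
    cancel = solve-∀

  move-negˡ : ∀ {x} m y n z → x ≡ (- m) * y + n * z → x + m * y ≡ n * z
  move-negˡ m y n z refl = cancel m y n z
    where
    cancel : ∀ m y n z → (- m) * y + n * z + m * y ≡ n * z
    cancel = solve-∀

  move-negʳ′ : ∀ {x} m y n z → x ≡ m * y + z * (- n) → x + z * n ≡ m * y
  move-negʳ′ m y n z refl = cancel m y n z
    where
    cancel : ∀ m y n z → m * y + z * (- n) + z * n ≡ m * y
    cancel = solve-∀

  move-neg : ∀ {x y} n → x + (- n) ≡ y → n + y ≡ x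
  move-neg {x} n refl = cancel x n
    where
    cancel : ∀ x n → n + (x + (- n)) ≡ x
    cancel = solve-∀

  pos-*³ : ∀ x y z → + (x ℕ.* y ℕ.* z) ≡ + x * + y * + z
  pos-*³ x y z = trans (pos-* (x ℕ.* y) z) (cong (_* + z) (pos-* x y))

  p≢Kq+c : ∀ {K p q c} → 1 ℕ.≤ K → p ℕ.< q → + p ≡ + K * + q + + c → ⊥
  p≢Kq+c {K} {p} {q} {c} 1≤K p<q p≡Kq+c = ℕ.<⇒≱ p<q (begin
    q              ≤⟨ ℕ.m≤n*m q K {{ℕ.>-nonZero 1≤K}} ⟩
    K ℕ.* q        ≤⟨ ℕ.m≤m+n (K ℕ.* q) c ⟩
    K ℕ.* q ℕ.+ c  ≡⟨ +-injective (trans p≡Kq+c (cong (_+ + c) (sym (pos-* K q)))) ⟨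
    p              ∎)
    where open ℕ.≤-Reasoning

  negative-a⇒⊥ : ∀ α B {p q r s t} → 1 ℕ.≤ p → q ℕ.< r → p ℕ.* p ℕ.< s → t ℕ.< p ℕ.* q →
                 + r ≡ -[1+ α ] * + q + + B * + p → + (p ℕ.* q) ≡ -[1+ α ] * + t + + B * + s → ⊥
  negative-a⇒⊥ α B {p} {q} {r} {s} {t} 1≤p q<r p²<s t<pq e3 e7 = ℕ.<⇒≱ p²<s (ℕ.<⇒≤ s<p²)
    where
    open ℕ.≤-Reasoning
    m : ℕ
    m = suc α
    r+mq≡Bp : r ℕ.+ m ℕ.* q ≡ B ℕ.* p
    r+mq≡Bp = pos-*-cast r m q B p (move-negˡ (+ m) (+ q) (+ B) (+ p) e3)
    pq+mt≡Bs : p ℕ.* q ℕ.+ m ℕ.* t ≡ B ℕ.* s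
    pq+mt≡Bs = pos-*-cast (p ℕ.* q) m t B s (move-negˡ (+ m) (+ t) (+ B) (+ s) e7)
    [1+m]q<Bp : suc m ℕ.* q ℕ.< B ℕ.* p
    [1+m]q<Bp = begin-strict
      q ℕ.+ m ℕ.* q   <⟨ ℕ.+-monoˡ-< (m ℕ.* q) q<r ⟩
      r ℕ.+ m ℕ.* q   ≡⟨ r+mq≡Bp ⟩
      B ℕ.* p         ∎
    Bs<[1+m]pq : B ℕ.* s ℕ.< suc m ℕ.* (p ℕ.* q)
    Bs<[1+m]pq = begin-strict
      B ℕ.* s                        ≡⟨ pq+mt≡Bs ⟨
      p ℕ.* q ℕ.+ m ℕ.* t            <⟨ ℕ.+-monoʳ-< (p ℕ.* q) (ℕ.*-monoʳ-< m t<pq) ⟩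
      p ℕ.* q ℕ.+ m ℕ.* (p ℕ.* q)    ∎
    s<p² : s ℕ.< p ℕ.* p
    s<p² = ℕ.*-cancelˡ-< B s (p ℕ.* p) (begin-strict
      B ℕ.* s                  <⟨ Bs<[1+m]pq ⟩
      suc m ℕ.* (p ℕ.* q)      ≡⟨ x∙yz≈y∙xz (suc m) p q ⟩
      p ℕ.* (suc m ℕ.* q)      <⟨ ℕ.*-monoʳ-< p {{ℕ.>-nonZero 1≤p}} [1+m]q<Bp ⟩
      p ℕ.* (B ℕ.* p)          ≡⟨ x∙yz≈y∙xz p B p ⟩
      B ℕ.* (p ℕ.* p)          ∎)

  positive-a⇒solution : ∀ A β K {p q s t} → 1 ℕ.≤ K → 2 ℕ.≤ p → t ℕ.< p ℕ.* q →
               + A * + A + -[1+ β ] ≡ + K * + p →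
               + p ≡ + K * + q + + A * -[1+ β ] →
               + q ≡ (+ A * + A * + A + + 3 * + A * -[1+ β ]) * + p + -[1+ β ] * -[1+ β ] * -[1+ β ] →
               + t ≡ + A * + s + -[1+ β ] * + (p ℕ.* p) → + (p ℕ.* q) ≡ + A * + t + -[1+ β ] * + s →
               + A ≡ + 2 × -[1+ β ] ≡ -[1+ 0 ] × p ≡ 3
  positive-a⇒solution A β K {p} {q} {s} {t} 1≤K 2≤p t<pq a²+b≡Kp p≡Kq+ab cubic-q e6 e7
    with unique-solution A β′ K p q s t (ℕ.s≤s ℕ.z≤n) 1≤K 2≤p A²≡Kp+β p+Aβ≡Kq cubic e6′ e7′ t<pq
    where
    β′ : ℕ
    β′ = suc β
    A²≡Kp+β : A ℕ.* A ≡ K ℕ.* p ℕ.+ β′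
    A²≡Kp+β = sym (trans (ℕ.+-comm (K ℕ.* p) β′) (pos-*-cast β′ K p A A (move-neg (+ β′) a²+b≡Kp)))
    p+Aβ≡Kq : p ℕ.+ A ℕ.* β′ ≡ K ℕ.* q
    p+Aβ≡Kq = pos-*-cast p A β′ K q (move-negʳ′ (+ K) (+ q) (+ β′) (+ A) p≡Kq+ab)
    cubic : q ℕ.+ β′ ℕ.* β′ ℕ.* β′ ℕ.+ 3 ℕ.* (A ℕ.* β′ ℕ.* p) ≡ A ℕ.* A ℕ.* A ℕ.* p
    cubic = +-injective (begin
      + q + + (β′ ℕ.* β′ ℕ.* β′) + + (3 ℕ.* (A ℕ.* β′ ℕ.* p))
        ≡⟨ cong₂ (λ u v → + q + u + v) (pos-*³ β′ β′ β′) (trans (pos-* 3 (A ℕ.* β′ ℕ.* p)) (cong (+ 3 *_) (pos-*³ A β′ p))) ⟩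
      + q + + β′ * + β′ * + β′ + + 3 * (+ A * + β′ * + p)
        ≡⟨ rearrange (+ q) (+ A) (+ β′) (+ p) cubic-q ⟩
      + A * + A * + A * + p
        ≡⟨ trans (pos-* (A ℕ.* A ℕ.* A) p) (cong (_* + p) (pos-*³ A A A)) ⟨
      + (A ℕ.* A ℕ.* A ℕ.* p) ∎)
      where
      open ≡-Reasoning
      rearrange : ∀ x A β P → x ≡ (A * A * A + + 3 * A * (- β)) * P + (- β) * (- β) * (- β) →
                  x + β * β * β + + 3 * (A * β * P) ≡ A * A * A * P
      rearrange x A β P refl = expand A β P
        where
        expand : ∀ A β P → (A * A * A + + 3 * A * (- β)) * P + (- β) * (- β) * (- β) + β * β * β + + 3 * (A * β * P)
                           ≡ A * A * A * P
        expand = solve-∀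
    e6′ : t ℕ.+ β′ ℕ.* (p ℕ.* p) ≡ A ℕ.* s
    e6′ = pos-*-cast t β′ (p ℕ.* p) A s (move-negʳ (+ A) (+ s) (+ β′) (+ (p ℕ.* p)) e6)
    e7′ : p ℕ.* q ℕ.+ β′ ℕ.* s ≡ A ℕ.* t
    e7′ = pos-*-cast (p ℕ.* q) β′ s A t (move-negʳ (+ A) (+ t) (+ β′) (+ s) e7)
  ... | A≡2 , β′≡1 , p≡3 = cong +_ A≡2 , cong -[1+_] (ℕ.suc-injective β′≡1) , p≡3

  -- If a b ≥ 0 then p = Kq + ab ≥ q; if a < 0 < b the recurrence forces s < p²; so a > 0 > b.
  sign-analysis : ∀ a b K {p q r s t} → 1 ℕ.≤ K → 2 ℕ.≤ p → p ℕ.< q → q ℕ.< r → p ℕ.* p ℕ.< s → t ℕ.< p ℕ.* q →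
                  a * a + b ≡ + K * + p → + p ≡ + K * + q + a * b →
                  + q ≡ (a * a * a + + 3 * a * b) * + p + b * b * b →
                  + r ≡ a * + q + b * + p → + t ≡ a * + s + b * + (p ℕ.* p) → + (p ℕ.* q) ≡ a * + t + b * + s →
                  a ≡ + 2 × b ≡ -[1+ 0 ] × p ≡ 3
  sign-analysis (+ A) (+ B) K {q = q} 1≤K _ p<q _ _ _ _ p≡Kq+ab _ _ _ _ =
    ⊥-elim (p≢Kq+c 1≤K p<q (trans p≡Kq+ab (cong (λ w → + K * + q + w) (sym (pos-* A B)))))
  sign-analysis -[1+ α ] -[1+ β ] K 1≤K _ p<q _ _ _ _ p≡Kq+ab _ _ _ _ = ⊥-elim (p≢Kq+c 1≤K p<q p≡Kq+ab)
  sign-analysis -[1+ α ] (+ B) K _ 2≤p _ q<r p²<s t<pq _ _ _ e3 _ e7 =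
    ⊥-elim (negative-a⇒⊥ α B (ℕ.≤-trans (ℕ.n≤1+n 1) 2≤p) q<r p²<s t<pq e3 e7)
  sign-analysis (+ A) -[1+ β ] K 1≤K 2≤p _ _ _ t<pq a²+b≡Kp p≡Kq+ab cubic-q _ e6 e7 =
    positive-a⇒solution A β K 1≤K 2≤p t<pq a²+b≡Kp p≡Kq+ab cubic-q e6 e7

  module SevenTerms (a b : ℤ) {p q r s t : ℕ} (prime-p : Prime p) (prime-q : Prime q) (prime-r : Prime r)
      (p<q : p ℕ.< q) (q<r : q ℕ.< r) (r<p² : r ℕ.< p ℕ.* p) (s<t : s ℕ.< t) (t<pq : t ℕ.< p ℕ.* q)
      (e3 : + r ≡ a * + q + b * + p) (e4 : + (p ℕ.* p) ≡ a * + r + b * + q) (e5 : + s ≡ a * + (p ℕ.* p) + b * + r)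
      (e6 : + t ≡ a * + s + b * + (p ℕ.* p)) (e7 : + (p ℕ.* q) ≡ a * + t + b * + s) where

    open DivisibilityByP a b prime-p prime-q prime-r p<q q<r e3 e4

    P : ℤ
    P = + p

    instance
      p≢0 : ℕ.NonZero p
      p≢0 = prime⇒nonZero prime-p

    k : ℤ
    k = _∣_.quotient p∣a²+b
    a²+b≡kp : a * a + b ≡ k * P
    a²+b≡kp = _∣_.equality p∣a²+b
    p≡kq+ab : P ≡ k * + q + a * b
    p≡kq+ab = *-cancelʳ-≡ P _ P (begin
      P * P                           ≡⟨ pos-* p p ⟨
      + (p ℕ.* p)                     ≡⟨ p²≡[a²+b]q+abp ⟩
      (a * a + b) * + q + a * b * P   ≡⟨ cong (λ z → z * + q + a * b * P) a²+b≡kp ⟩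
      k * P * + q + a * b * P         ≡⟨ factor k P (+ q) (a * b) ⟩
      (k * + q + a * b) * P           ∎)
      where
      open ≡-Reasoning
      factor : ∀ k P q c → k * P * q + c * P ≡ (k * q + c) * P
      factor = solve-∀
    q≡ks+abp : + q ≡ k * + s + a * b * P
    q≡ks+abp = *-cancelʳ-≡ (+ q) _ P (begin
      + q * P                                      ≡⟨ ℤ.*-comm (+ q) P ⟩
      P * + q                                      ≡⟨ pos-* p q ⟨
      + (p ℕ.* q)                                  ≡⟨ x≡[a²+b]s+abp² e6 e7 ⟩
      (a * a + b) * + s + a * b * + (p ℕ.* p)      ≡⟨ cong₂ (λ u v → u * + s + a * b * v) a²+b≡kp (pos-* p p) ⟩
      k * P * + s + a * b * (P * P)                ≡⟨ factor k P (+ s) (a * b) ⟩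
      (k * + s + a * b * P) * P                    ∎)
      where
      open ≡-Reasoning
      factor : ∀ k P s c → k * P * s + c * (P * P) ≡ (k * s + c * P) * P
      factor = solve-∀
    kpq+q≡p²+ks : k * (P * + q) + + q ≡ P * P + k * + s
    kpq+q≡p²+ks = begin
      k * (P * + q) + + q                              ≡⟨ cong (λ w → k * (P * + q) + w) q≡ks+abp ⟩
      k * (P * + q) + (k * + s + a * b * P)            ≡⟨ cong (λ w → k * (P * + q) + (k * + s + w * P)) ab≡p-kq ⟩
      k * (P * + q) + (k * + s + (P - k * + q) * P)    ≡⟨ simplify k P (+ q) (+ s) ⟩
      P * P + k * + s                                  ∎
      where
      open ≡-Reasoning
      simplify : ∀ k P q s → k * (P * q) + (k * s + (P - k * q) * P) ≡ P * P + k * s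
      simplify = solve-∀
      ab≡p-kq : a * b ≡ P - k * + q
      ab≡p-kq = trans (isolate k (+ q) (a * b)) (cong (_- k * + q) (sym p≡kq+ab))
        where
        isolate : ∀ k q c → c ≡ (k * q + c) - k * q
        isolate = solve-∀
    quotient-positive : ∃ λ K → k ≡ + suc K
    quotient-positive = positive k kpq+q≡p²+ks
      where
      positive : ∀ j → j * (P * + q) + + q ≡ P * P + j * + s → ∃ λ K → j ≡ + suc K
      positive (+ suc K) _ = K , refl
      positive (+ 0) eq = ⊥-elim (ℕ.<-irrefl q≡p² (ℕ.<-trans q<r r<p²))
        where
        drop0 : ∀ X Y Z W → + 0 * X + Y ≡ Z + + 0 * W → Y ≡ Z
        drop0 X Y Z W eq = trans (add0ˡ X Y) (trans eq (add0ʳ W Z))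
          where
          add0ˡ : ∀ X Y → Y ≡ + 0 * X + Y
          add0ˡ = solve-∀
          add0ʳ : ∀ W Z → Z + + 0 * W ≡ Z
          add0ʳ = solve-∀
        q≡p² : q ≡ p ℕ.* p
        q≡p² = +-injective (trans (drop0 (P * + q) (+ q) (P * P) (+ s) eq) (sym (pos-* p p)))
      positive -[1+ n ] eq = ⊥-elim (ℕ.<-irrefl q+ms≡p²+mpq (ℕ.+-mono-< (ℕ.<-trans q<r r<p²) (ℕ.*-monoʳ-< m (ℕ.<-trans s<t t<pq))))
        where
        m : ℕ
        m = suc n
        swap : ∀ m X Y Z W → (- m) * X + Y ≡ Z + (- m) * W → Y + m * W ≡ Z + m * X
        swap m X Y Z W eq = begin
          Y + m * W                                ≡⟨ expand m X Y W ⟩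
          ((- m) * X + Y) + m * X + m * W          ≡⟨ cong (λ v → v + m * X + m * W) eq ⟩
          (Z + (- m) * W) + m * X + m * W          ≡⟨ contract m X Z W ⟩
          Z + m * X                                ∎
          where
          open ≡-Reasoning
          expand : ∀ m X Y W → Y + m * W ≡ ((- m) * X + Y) + m * X + m * W
          expand = solve-∀
          contract : ∀ m X Z W → (Z + (- m) * W) + m * X + m * W ≡ Z + m * X
          contract = solve-∀
        q+ms≡p²+mpq : q ℕ.+ m ℕ.* s ≡ p ℕ.* p ℕ.+ m ℕ.* (p ℕ.* q)
        q+ms≡p²+mpq = +-injective (begin
          + q + + (m ℕ.* s)                     ≡⟨ cong (λ w → + q + w) (pos-* m s) ⟩
          + q + + m * + s                       ≡⟨ swap (+ m) (P * + q) (+ q) (P * P) (+ s) eq ⟩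
          P * P + + m * (P * + q)               ≡⟨ cong₂ (λ u v → u + + m * v) (pos-* p p) (pos-* p q) ⟨
          + (p ℕ.* p) + + m * + (p ℕ.* q)       ≡⟨ cong (λ w → + (p ℕ.* p) + w) (pos-* m (p ℕ.* q)) ⟨
          + (p ℕ.* p) + + (m ℕ.* (p ℕ.* q))     ∎)
          where open ≡-Reasoning
    q≡[a³+3ab]p+b³ : + q ≡ (a * a * a + + 3 * a * b) * P + b * b * b
    q≡[a³+3ab]p+b³ = *-cancelʳ-≡ (+ q) _ P (begin
      + q * P                                      ≡⟨ ℤ.*-comm (+ q) P ⟩
      P * + q                                      ≡⟨ pos-* p q ⟨
      + (p ℕ.* q)                                  ≡⟨ x₇≡ ⟩
      x₇                                           ≡⟨ unroll a b P (+ q) ⟩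
      (a * a * a + + 3 * a * b) * x₄ + b * b * b * P ≡⟨ cong (λ w → (a * a * a + + 3 * a * b) * w + b * b * b * P)
                                                            (trans (sym x₄≡) (pos-* p p)) ⟩
      (a * a * a + + 3 * a * b) * (P * P) + b * b * b * P ≡⟨ factor (a * a * a + + 3 * a * b) P (b * b * b) ⟩
      ((a * a * a + + 3 * a * b) * P + b * b * b) * P ∎)
      where
      open ≡-Reasoning
      x₃ x₄ x₅ x₆ x₇ : ℤ
      x₃ = a * + q + b * P
      x₄ = a * x₃ + b * + q
      x₅ = a * x₄ + b * x₃
      x₆ = a * x₅ + b * x₄
      x₇ = a * x₆ + b * x₅
      x₄≡ : + (p ℕ.* p) ≡ x₄
      x₄≡ = trans e4 (cong (λ z → a * z + b * + q) e3)
      x₅≡ : + s ≡ x₅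
      x₅≡ = trans e5 (cong₂ (λ u v → a * u + b * v) x₄≡ e3)
      x₆≡ : + t ≡ x₆
      x₆≡ = trans e6 (cong₂ (λ u v → a * u + b * v) x₅≡ x₄≡)
      x₇≡ : + (p ℕ.* q) ≡ x₇
      x₇≡ = trans e7 (cong₂ (λ u v → a * u + b * v) x₆≡ x₅≡)
      unroll : ∀ a b x₁ x₂ →
        a * (a * (a * (a * (a * x₂ + b * x₁) + b * x₂) + b * (a * x₂ + b * x₁)) + b * (a * (a * x₂ + b * x₁) + b * x₂))
          + b * (a * (a * (a * x₂ + b * x₁) + b * x₂) + b * (a * x₂ + b * x₁))
        ≡ (a * a * a + + 3 * a * b) * (a * (a * x₂ + b * x₁) + b * x₂) + b * b * b * x₁
      unroll = solve-∀
      factor : ∀ c P d → c * (P * P) + d * P ≡ (c * P + d) * P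
      factor = solve-∀

  recurrence-coefficients : ∀ a b {p q r s t} → Prime p → Prime q → Prime r →
    p ℕ.< q → q ℕ.< r → r ℕ.< p ℕ.* p → p ℕ.* p ℕ.< s → s ℕ.< t → t ℕ.< p ℕ.* q →
    + r ≡ a * + q + b * + p → + (p ℕ.* p) ≡ a * + r + b * + q → + s ≡ a * + (p ℕ.* p) + b * + r →
    + t ≡ a * + s + b * + (p ℕ.* p) → + (p ℕ.* q) ≡ a * + t + b * + s →
    a ≡ + 2 × b ≡ -[1+ 0 ] × p ≡ 3
  recurrence-coefficients a b {p} {q} prime-p prime-q prime-r p<q q<r r<p² p²<s s<t t<pq e3 e4 e5 e6 e7 =
    sign-analysis a b (suc K) (ℕ.s≤s ℕ.z≤n) (prime⇒1<p prime-p) p<q q<r p²<s t<pq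
      (subst (λ k → a * a + b ≡ k * + p) k≡1+K a²+b≡kp) (subst (λ k → + p ≡ k * + q + a * b) k≡1+K p≡kq+ab)
      q≡[a³+3ab]p+b³ e3 e6 e7
    where
    open SevenTerms a b prime-p prime-q prime-r p<q q<r r<p² s<t t<pq e3 e4 e5 e6 e7
    K : ℕ
    K = proj₁ quotient-positive
    k≡1+K : k ≡ + suc K
    k≡1+K = proj₂ quotient-positive

module SeventhDivisor where

  open import Defs
  open import Data.Nat
  open import Data.Nat.Properties
  open import Data.Nat.Divisibility using (_∣_; divides; ∣-trans; ∣⇒≤; >⇒∤; m∣m*n)
  open import Data.Nat.Coprimality using (Coprime)
  import Data.Nat.Coprimality as Coprime
  open import Data.Nat.Primality using (Prime; prime⇒nonZero)
  open import Data.Nat.Tactic.RingSolver using (solve-∀)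
  open import Data.Integer using (ℤ)
  open import Data.List using ([]; _∷_)
  open import Data.List.Membership.Propositional using (_∈_)
  open import Data.List.Relation.Unary.Any using (here; there)
  import Data.List.Relation.Unary.Any as Any
  open import Data.List.Relation.Unary.Any.Properties using (¬Any[])
  open import Data.List.Relation.Unary.All using (_∷_)
  open import Data.List.Relation.Unary.AllPairs using (AllPairs; []; _∷_)
  open import Data.Product using (_×_; _,_; ∃; proj₁; proj₂)
  open import Data.Empty using (⊥; ⊥-elim)
  open import Relation.Nullary using (¬_; yes; no)
  open import Relation.Binary.PropositionalEquality
  open Primes using (prime⇒1<p; prime∤larger-prime; ¬∣⇒coprime; prime∤*⇒∤; coprime⇒*∣)
  open SmallDivisors
  open Coefficients using (module DivisibilityByP)

  module _ {p q r : ℕ} (prime-p : Prime p) (prime-q : Prime q) (prime-r : Prime r)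
           (p<q : p < q) (q<r : q < r) (N : ℕ) where

    private
      instance
        p≢0 : NonZero p
        p≢0 = prime⇒nonZero prime-p
        q≢0 : NonZero q
        q≢0 = prime⇒nonZero prime-q
      1<p : 1 < p
      1<p = prime⇒1<p prime-p

    p*q∈S′ : ∀ {rest} → S′ N ≡ p ∷ q ∷ r ∷ p * p ∷ rest → p * q ∈ S′ N
    p*q∈S′ {rest} eq = ∈S′⁺ (*-mono-< 1<p (<-trans 1<p p<q)) [pq]²<N (coprime⇒*∣ p⊥q p∣N q∣N)
      where
      member : ∀ {d} → d ∈ p ∷ q ∷ r ∷ p * p ∷ rest → 1 < d × d * d < N × d ∣ N
      member d∈ = ∈S′⁻ N (subst (_ ∈_) (sym eq) d∈)
      p∣N : p ∣ N
      p∣N = proj₂ (proj₂ (member (here refl)))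
      q∣N : q ∣ N
      q∣N = proj₂ (proj₂ (member (there (here refl))))
      r∣N : r ∣ N
      r∣N = proj₂ (proj₂ (member (there (there (here refl)))))
      p²∣N : p * p ∣ N
      p²∣N = proj₂ (proj₂ (member (there (there (there (here refl))))))
      p²<N : p * p < N
      p²<N = proj₁ (proj₂ (member (here refl)))
      p⊥q : Coprime p q
      p⊥q = ¬∣⇒coprime prime-p (prime∤larger-prime prime-p prime-q p<q)
      p²⊥q : Coprime (p * p) q
      p²⊥q = Coprime.sym (¬∣⇒coprime prime-q (prime∤*⇒∤ prime-q (>⇒∤ p<q) (>⇒∤ p<q)))
      p²q⊥r : Coprime (p * p * q) r
      p²q⊥r = Coprime.sym (¬∣⇒coprime prime-r (prime∤*⇒∤ prime-r (prime∤*⇒∤ prime-r (>⇒∤ p<r) (>⇒∤ p<r)) (>⇒∤ q<r)))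
        where
        p<r : p < r
        p<r = <-trans p<q q<r
      [pq]²<N : p * q * (p * q) < N
      [pq]²<N = begin-strict
        p * q * (p * q)      ≡⟨ regroup p q ⟩
        p * p * q * q        <⟨ *-monoʳ-< (p * p * q) {{m*n≢0 (p * p) q {{m*n≢0 p p}}}} q<r ⟩
        p * p * q * r        ≤⟨ ∣⇒≤ {{>-nonZero (≤-<-trans z≤n p²<N)}} (coprime⇒*∣ p²q⊥r (coprime⇒*∣ p²⊥q p²∣N q∣N) r∣N) ⟩
        N                    ∎
        where
        open ≤-Reasoning
        regroup : ∀ p q → p * q * (p * q) ≡ p * p * q * q
        regroup = solve-∀

    -- With x = c p, also c ∈ S′ N, and nothing in S′ N lies strictly between p and q.
    p*q≤multiple : ∀ {L x} → S′ N ≡ p ∷ q ∷ L → p ∣ x → x ∈ S′ N → p * p < x → p * q ≤ x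
    p*q≤multiple {L} {x} eq (divides c x≡cp) x∈S′ p²<x = begin
      p * q    ≡⟨ *-comm p q ⟩
      q * p    ≤⟨ *-monoˡ-≤ p q≤c ⟩
      c * p    ≡⟨ x≡cp ⟨
      x        ∎
      where
      open ≤-Reasoning
      p<c : p < c
      p<c = *-cancelʳ-< p p c (subst (p * p <_) x≡cp p²<x)
      c≤x : c ≤ x
      c≤x = subst (c ≤_) (sym x≡cp) (m≤m*n c p)
      c∈S′ : c ∈ S′ N
      c∈S′ = ∈S′⁺ (<-trans 1<p p<c) (≤-<-trans (*-mono-≤ c≤x c≤x) (proj₁ (proj₂ (∈S′⁻ N x∈S′))))
                  (∣-trans (divides p (trans x≡cp (*-comm c p))) (proj₂ (proj₂ (∈S′⁻ N x∈S′))))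
      q≤c : q ≤ c
      q≤c with q ≤? c
      ... | yes q≤c = q≤c
      ... | no q≰c = ⊥-elim (sorted-gap (subst (AllPairs _<_) eq (S′-sorted N)) (subst (c ∈_) eq c∈S′) p<c (≰⇒> q≰c))

    PQSeventh : Set
    PQSeventh = ∃ λ s → ∃ λ t → ∃ λ rest →
      S′ N ≡ p ∷ q ∷ r ∷ p * p ∷ s ∷ t ∷ p * q ∷ rest × p * p < s × s < t × t < p * q

    seventh-divisor : ∀ {a b : ℤ} {rest} → S′ N ≡ p ∷ q ∷ r ∷ p * p ∷ rest → Rec a b (S′ N) → PQSeventh
    seventh-divisor {a} {b} {rest} eq rec = locate rest eq (proj₂ (proj₂ rec′)) p*q∈rest
      where
      rec′ : Rec a b (p ∷ q ∷ r ∷ p * p ∷ rest)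
      rec′ = subst (Rec a b) eq rec
      open DivisibilityByP a b prime-p prime-q prime-r p<q q<r (proj₁ rec′) (proj₁ (proj₂ rec′)) using (p∤s; p∤t; p∣x)
      p*q∈rest : p * q ∈ rest
      p*q∈rest = sorted-∈-after (p ∷ q ∷ r ∷ []) (subst (AllPairs _<_) eq (S′-sorted N))
                   (subst (_ ∈_) eq (p*q∈S′ eq)) (*-monoʳ-< p p<q)
      skip : ∀ {y ys} → ¬ p ∣ y → p * q ∈ y ∷ ys → p * q ∈ ys
      skip p∤y = Any.tail (λ pq≡y → p∤y (subst (p ∣_) pq≡y (m∣m*n q)))
      locate : ∀ rest → S′ N ≡ p ∷ q ∷ r ∷ p * p ∷ rest → Rec a b (r ∷ p * p ∷ rest) → p * q ∈ rest → PQSeventh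
      locate [] _ _ ()
      locate (s ∷ []) _ (e5 , _) pq∈ = ⊥-elim (¬Any[] (skip (p∤s e5) pq∈))
      locate (s ∷ t ∷ []) _ (e5 , e6 , _) pq∈ = ⊥-elim (¬Any[] (skip (p∤t (p∤s e5) e6) (skip (p∤s e5) pq∈)))
      locate (s ∷ t ∷ x ∷ rest₃) eq (e5 , e6 , e7 , _) pq∈ = located (subst (AllPairs _<_) eq (S′-sorted N))
        where
        located : AllPairs _<_ (p ∷ q ∷ r ∷ p * p ∷ s ∷ t ∷ x ∷ rest₃) → PQSeventh
        located (_ ∷ _ ∷ _ ∷ (p²<s ∷ _) ∷ (s<t ∷ _) ∷ (t<x ∷ _) ∷ x-sorted) =
          s , t , rest₃ , subst (λ z → S′ N ≡ p ∷ q ∷ r ∷ p * p ∷ s ∷ t ∷ z ∷ rest₃) x≡pq eq ,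
          p²<s , s<t , subst (t <_) x≡pq t<x
          where
          x∈S′ : x ∈ S′ N
          x∈S′ = subst (x ∈_) (sym eq) (there (there (there (there (there (there (here refl)))))))
          x≡pq : x ≡ p * q
          x≡pq = ≤-antisym (sorted-head-≤ x-sorted (skip (p∤t (p∤s e5) e6) (skip (p∤s e5) pq∈)))
                           (p*q≤multiple eq (p∣x e6 e7) x∈S′ (<-trans p²<s (<-trans s<t t<x)))

module OddRun where

  open import Defs
  open import Data.Nat
  open import Data.Nat.Properties
  open import Data.Nat.Divisibility using (_∣_; _∣?_; ∣⇒≤)
  open import Data.Nat.Coprimality using (Coprime)
  open import Data.Nat.Tactic.RingSolver using (solve-∀)
  open import Data.Integer as ℤ using (+_; -[1+_])
  open import Data.List using ([]; _∷_; _++_)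
  open import Data.List.Properties using (++-assoc)
  open import Data.List.Membership.Propositional using (_∈_)
  open import Data.List.Membership.Propositional.Properties using (∈-++⁺ʳ)
  open import Data.List.Relation.Unary.Any using (here; there)
  open import Data.List.Relation.Unary.AllPairs using (AllPairs)
  open import Data.Product using (_×_; _,_; ∃; proj₁; proj₂)
  open import Data.Empty using (⊥)
  open import Relation.Nullary using (¬_; Dec; yes; no)
  open import Relation.Nullary.Decidable using (from-no)
  open import Relation.Binary.PropositionalEquality
  open Primes
  open SmallDivisors
  open Coefficients using (pos-*-cast; move-negʳ)

  z≡2y-x⇒z+x≡2y : ∀ {x y z} → + z ≡ + 2 ℤ.* + y ℤ.+ -[1+ 0 ] ℤ.* + x → z + x ≡ 2 * y
  z≡2y-x⇒z+x≡2y {x} {y} {z} step =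
    trans (cong (λ w → z + w) (sym (*-identityˡ x))) (pos-*-cast z 1 x 2 y (move-negʳ (+ 2) (+ y) (+ 1) (+ x) step))

  9[u+4]²<u[u+2][u+4] : ∀ u → 11 ≤ u → 3 * (u + 4) * (3 * (u + 4)) < u * (u + 2) * (u + 4)
  9[u+4]²<u[u+2][u+4] u 11≤u with m≤n⇒∃[o]m+o≡n 11≤u
  ... | m , refl = subst (3 * (11 + m + 4) * (3 * (11 + m + 4)) <_) (sym (split m)) (m<m+n _ z<s)
    where
    split : ∀ m → (11 + m) * (11 + m + 2) * (11 + m + 4) ≡ 3 * (11 + m + 4) * (3 * (11 + m + 4)) + (15 + m) * (8 + 15 * m + m * m)
    split = solve-∀

  module _ (N : ℕ) (rec : Rec (+ 2) -[1+ 0 ] (S′ N)) (3∣N : 3 ∣ N) where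

    divisor-beyond : ∀ {xs u rest} → ¬ 2 ∣ u → 11 ≤ u → S′ N ≡ xs ++ u ∷ u + 2 ∷ u + 4 ∷ rest →
                     ∃ λ d → d ∈ S′ N × u + 4 < d
    divisor-beyond {xs} {u} {rest} 2∤u 11≤u eq = by-three (3 ∣? v)
      where
      v w : ℕ
      v = u + 2
      w = u + 4
      member : ∀ {y} → y ∈ u ∷ v ∷ w ∷ rest → 1 < y × y * y < N × y ∣ N
      member y∈ = ∈S′⁻ N (subst (_ ∈_) (sym eq) (∈-++⁺ʳ xs y∈))
      u∣N : u ∣ N
      u∣N = proj₂ (proj₂ (member (here refl)))
      v∣N : v ∣ N
      v∣N = proj₂ (proj₂ (member (there (here refl))))
      w∣N : w ∣ N
      w∣N = proj₂ (proj₂ (member (there (there (here refl)))))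
      u²<N : u * u < N
      u²<N = proj₁ (proj₂ (member (here refl)))
      v≤w : v ≤ w
      v≤w = +-monoʳ-≤ u (s≤s (s≤s z≤n))
      v⊥w : Coprime v w
      v⊥w = subst (Coprime v) (+-assoc u 2 2) (odd⇒coprime-+2 (odd⇒odd-+2 2∤u))
      uvw≤N : u * v * w ≤ N
      uvw≤N = ∣⇒≤ {{>-nonZero (≤-<-trans z≤n u²<N)}}
                (coprime⇒*∣ (coprime-*ˡ (odd⇒coprime-+4 2∤u) v⊥w) (coprime⇒*∣ (odd⇒coprime-+2 2∤u) u∣N v∣N) w∣N)
      tripled : ∀ c → ¬ 3 ∣ c → c ∣ N → v ≤ c → c ≤ w → ∃ λ d → d ∈ S′ N × w < d
      tripled c 3∤c c∣N v≤c c≤w = 3 * c , ∈S′⁺ (<-trans 1<w w<3c) [3c]²<N 3c∣N , w<3c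
        where
        w<3c : w < 3 * c
        w<3c = <-≤-trans (subst (w <_) (sym (split u)) (m<m+n w z<s)) (*-monoʳ-≤ 3 v≤c)
          where
          split : ∀ u → 3 * (u + 2) ≡ u + 4 + suc (2 * u + 1)
          split = solve-∀
        1<w : 1 < w
        1<w = ≤-trans (s≤s (s≤s z≤n)) (m≤n+m 4 u)
        [3c]²<N : 3 * c * (3 * c) < N
        [3c]²<N = ≤-<-trans (*-mono-≤ (*-monoʳ-≤ 3 c≤w) (*-monoʳ-≤ 3 c≤w))
                            (<-≤-trans (9[u+4]²<u[u+2][u+4] u 11≤u) uvw≤N)
        3c∣N : 3 * c ∣ N
        3c∣N = coprime⇒*∣ (¬∣⇒coprime prime[3] 3∤c) 3∣N c∣N
      by-three : Dec (3 ∣ v) → ∃ λ d → d ∈ S′ N × w < d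
      by-three (yes 3∣v) = tripled w (subst (λ z → ¬ 3 ∣ z) (+-assoc u 2 2) (3∣v⇒3∤v+2 v 3∣v)) w∣N v≤w ≤-refl
      by-three (no 3∤v) = tripled v 3∤v v∣N ≤-refl v≤w

    -- The run u, u + 2, u + 4 is shifted by 2 at each step and stays below N, so fuel N suffices.
    escape : ∀ fuel xs u rest → ¬ 2 ∣ u → 11 ≤ u → S′ N ≡ xs ++ u ∷ u + 2 ∷ u + 4 ∷ rest → N ≤ u + fuel → ⊥
    escape zero xs u rest _ _ eq N≤u+0 =
      <⇒≱ (∈S′⇒<N N (subst (u + 4 ∈_) (sym eq) (∈-++⁺ʳ xs (there (there (here refl))))))
          (≤-trans N≤u+0 (+-monoʳ-≤ u z≤n))
    escape (suc fuel) xs u rest 2∤u 11≤u eq N≤u+1+f = continue rest eq d∈rest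
      where
      beyond : ∃ λ d → d ∈ S′ N × u + 4 < d
      beyond = divisor-beyond 2∤u 11≤u eq
      d : ℕ
      d = proj₁ beyond
      reassoc : ∀ {rest} → S′ N ≡ xs ++ u ∷ u + 2 ∷ u + 4 ∷ rest → S′ N ≡ (xs ++ u ∷ u + 2 ∷ []) ++ u + 4 ∷ rest
      reassoc {rest} eq = trans eq (sym (++-assoc xs (u ∷ u + 2 ∷ []) (u + 4 ∷ rest)))
      d∈rest : d ∈ rest
      d∈rest = sorted-∈-after (xs ++ u ∷ u + 2 ∷ []) (subst (AllPairs _<_) (reassoc eq) (S′-sorted N))
                 (subst (d ∈_) (reassoc eq) (proj₁ (proj₂ beyond))) (proj₂ (proj₂ beyond))
      continue : ∀ rest → S′ N ≡ xs ++ u ∷ u + 2 ∷ u + 4 ∷ rest → d ∈ rest → ⊥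
      continue [] _ ()
      continue (y ∷ rest′) eq _ = escape fuel (xs ++ u ∷ []) (u + 2) rest′ (odd⇒odd-+2 2∤u)
                                    (≤-trans 11≤u (m≤m+n u 2)) shifted N≤u+2+f
        where
        y+v≡2w : y + (u + 2) ≡ 2 * (u + 4)
        y+v≡2w = z≡2y-x⇒z+x≡2y {u + 2} {u + 4} {y}
                   (proj₁ (proj₂ (Rec-++⁻ xs {u ∷ u + 2 ∷ u + 4 ∷ y ∷ rest′} (subst (Rec (+ 2) -[1+ 0 ]) eq rec))))
        y≡u+2+4 : y ≡ u + 2 + 4
        y≡u+2+4 = +-cancelʳ-≡ (u + 2) y (u + 2 + 4) (trans y+v≡2w (split u))
          where
          split : ∀ u → 2 * (u + 4) ≡ u + 2 + 4 + (u + 2)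
          split = solve-∀
        shifted : S′ N ≡ (xs ++ u ∷ []) ++ u + 2 ∷ u + 2 + 2 ∷ u + 2 + 4 ∷ rest′
        shifted = trans eq (trans (cong₂ (λ w y → xs ++ u ∷ u + 2 ∷ w ∷ y ∷ rest′) (sym (+-assoc u 2 2)) y≡u+2+4)
                                  (sym (++-assoc xs (u ∷ []) _)))
        N≤u+2+f : N ≤ u + 2 + fuel
        N≤u+2+f = ≤-trans N≤u+1+f (≤-trans (+-monoʳ-≤ u (n≤1+n (suc fuel))) (≤-reflexive (sym (+-assoc u 2 fuel))))

  no-odd-run : ∀ N {rest} → Rec (+ 2) -[1+ 0 ] (S′ N) → S′ N ≡ 3 ∷ 5 ∷ 7 ∷ 9 ∷ 11 ∷ 13 ∷ 15 ∷ rest → ⊥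
  no-odd-run N {rest} rec eq = escape N rec 3∣N N (3 ∷ 5 ∷ 7 ∷ 9 ∷ []) 11 rest (from-no (2 ∣? 11)) ≤-refl eq (m≤n+m N 11)
    where
    3∣N : 3 ∣ N
    3∣N = proj₂ (proj₂ (∈S′⁻ N (subst (3 ∈_) (sym eq) (here refl))))

open import Defs
open import Data.Nat using (ℕ; _<_; _*_; _+_)
import Data.Nat.Properties as ℕ
open import Data.Nat.Tactic.RingSolver using (solve-∀)
open import Data.Nat.Primality using (Prime)
open import Data.Integer as ℤ using (+_; -[1+_])
open import Data.List using (List; _∷_)
open import Data.Product using (∃; _×_; _,_)
open import Relation.Binary.PropositionalEquality using (_≡_; refl; subst; subst₂; trans; sym; cong; module ≡-Reasoning)
open import Relation.Nullary using (¬_)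
open SeventhDivisor using (seventh-divisor)
open OddRun using (no-odd-run; z≡2y-x⇒z+x≡2y)
open Coefficients using (recurrence-coefficients)

first-terms : ∀ {a b p q r s t} → a ≡ + 2 → b ≡ -[1+ 0 ] → p ≡ 3 →
  + r ≡ a ℤ.* + q ℤ.+ b ℤ.* + p → + (p * p) ≡ a ℤ.* + r ℤ.+ b ℤ.* + q →
  + s ≡ a ℤ.* + (p * p) ℤ.+ b ℤ.* + r → + t ≡ a ℤ.* + s ℤ.+ b ℤ.* + (p * p) →
  ∀ rest → p ∷ q ∷ r ∷ p * p ∷ s ∷ t ∷ p * q ∷ rest ≡ 3 ∷ 5 ∷ 7 ∷ 9 ∷ 11 ∷ 13 ∷ 15 ∷ rest
first-terms {q = q} {r} {s} {t} refl refl refl e3 e4 e5 e6 rest = listed q≡5 r≡7 s≡11 t≡13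
  where
  r+3≡2q : r + 3 ≡ 2 * q
  r+3≡2q = z≡2y-x⇒z+x≡2y {3} {q} {r} e3
  q≡5 : q ≡ 5
  q≡5 = ℕ.*-cancelˡ-≡ q 5 3 (ℕ.+-cancelʳ-≡ q (3 * q) 15 (begin
    3 * q + q          ≡⟨ four q ⟩
    2 * (2 * q)        ≡⟨ cong (2 *_) r+3≡2q ⟨
    2 * (r + 3)        ≡⟨ spread r ⟩
    2 * r + 6          ≡⟨ cong (_+ 6) (z≡2y-x⇒z+x≡2y {q} {r} {9} e4) ⟨
    9 + q + 6          ≡⟨ collect q ⟩
    15 + q             ∎))
    where
    open ≡-Reasoning
    four : ∀ q → 3 * q + q ≡ 2 * (2 * q)
    four = solve-∀
    spread : ∀ r → 2 * (r + 3) ≡ 2 * r + 6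
    spread = solve-∀
    collect : ∀ q → 9 + q + 6 ≡ 15 + q
    collect = solve-∀
  r≡7 : r ≡ 7
  r≡7 = ℕ.+-cancelʳ-≡ 3 r 7 (trans r+3≡2q (cong (2 *_) q≡5))
  s≡11 : s ≡ 11
  s≡11 = ℕ.+-cancelʳ-≡ 7 s 11 (trans (cong (λ w → s + w) (sym r≡7)) (z≡2y-x⇒z+x≡2y {r} {9} {s} e5))
  t≡13 : t ≡ 13
  t≡13 = ℕ.+-cancelʳ-≡ 9 t 13 (trans (z≡2y-x⇒z+x≡2y {9} {s} {t} e6) (cong (2 *_) s≡11))
  listed : q ≡ 5 → r ≡ 7 → s ≡ 11 → t ≡ 13 → 3 ∷ q ∷ r ∷ 9 ∷ s ∷ t ∷ 3 * q ∷ rest ≡ 3 ∷ 5 ∷ 7 ∷ 9 ∷ 11 ∷ 13 ∷ 15 ∷ rest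
  listed refl refl refl refl = refl

proposition3p4 : (p q r : ℕ) → Prime p → Prime q → Prime r → p < q → q < r → r < p * p →
    ¬ (∃ λ (N : ℕ) → 1 < N × SmallRecurrent N × ∃ λ (rest : List ℕ) → S′ N ≡ p ∷ q ∷ r ∷ p * p ∷ rest)
proposition3p4 p q r prime-p prime-q prime-r p<q q<r r<p² (N , _ , (a , b , rec) , rest , eq) =
  let s , t , rest′ , eq′ , p²<s , s<t , t<pq = seventh-divisor prime-p prime-q prime-r p<q q<r N eq rec
      e3 , e4 , e5 , e6 , e7 , _ = subst (Rec a b) eq′ rec
      a≡2 , b≡-1 , p≡3 = recurrence-coefficients a b prime-p prime-q prime-r p<q q<r r<p² p²<s s<t t<pq e3 e4 e5 e6 e7
  in no-odd-run N (subst₂ (λ a b → Rec a b (S′ N)) a≡2 b≡-1 rec)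
               (trans eq′ (first-terms a≡2 b≡-1 p≡3 e3 e4 e5 e6 rest′))
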